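{- For any two labeled posets $(P,\omega)$ and $(Q,\omega')$, $K_{(P,\omega)\uparrow(Q,\omega')}=K_{(P,\omega)}\uparrow K_{(Q,\omega')}$ and $K_{(P,\omega)\Uparrow(Q,\omega')}=K_{(P,\omega)}\Uparrow K_{(Q,\omega')}$.
   Context: A labeled poset $(P,\omega)$ is a finite poset $P$ with $|P|=n$ and a bijection $\omega:P\to[n]$; a cover relation $a\prec_P b$ is a strict edge if $\omega(a)>\omega(b)$ and a weak edge otherwise. A $(P,\omega)$-partition is a map $f:P\to\{1,2,\dots\}$ with $f(a)\le f(b)$ whenever $a<_Pb$, and $f(a)<f(b)$ whenever $a<_Pb$ and $\omega(a)>\omega(b)$; $K_{(P,\omega)}(\mathbf{x})=\sum_f x_1^{\#f^{ -1}(1)}x_2^{\#f^{ -1}(2)}\cdots$ over all $(P,\omega)$-partitions. The weak (resp. strict) ordinal sum $(P,\omega)\uparrow(Q,\omega')$ (resp. $(P,\omega)\Uparrow(Q,\omega')$) is the labeled poset obtained by placing $P$ below $Q$ and adding a weak (resp. strict) edge from each maximal element of $P$ to each minimal element of $Q$, other edges keeping their type; explicitly, $(P,\omega)\uparrow(Q,\omega')$ is labeled by keeping $\omega$ on $P$ and using $\omega'+|P|$ on $Q$, and $(P,\omega)\Uparrow(Q,\omega')$ by using $\omega+|Q|$ on $P$ and $\omega'$ on $Q$. On compositions, $(\alpha_1,\dots,\alpha_k)\uparrow(\beta_1,\dots,\beta_\ell)=(\alpha_1,\dots,\alpha_{k-1},\alpha_k+\beta_1,\beta_2,\dots,\beta_\ell)$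 and $(\alpha_1,\dots,\alpha_k)\Uparrow(\beta_1,\dots,\beta_\ell)=(\alpha_1,\dots,\alpha_k,\beta_1,\dots,\beta_\ell)$. These define bilinear products on $\mathrm{QSym}$ via $F_\alpha\uparrow F_\beta=F_{\alpha\uparrow\beta}$ and $F_\alpha\Uparrow F_\beta=F_{\alpha\Uparrow\beta}$, where for a composition $\alpha$ of $n$ with partial-sum set $S(\alpha)=\{\alpha_1,\alpha_1+\alpha_2,\dots\}\subseteq[n-1]$, $F_\alpha=\sum_{S(\alpha)\subseteq T\subseteq[n-1]}M_{T,n}$ is the fundamental quasisymmetric function and $M_{T,n}$ the monomial quasisymmetric function $\sum_{i_1<\dots<i_k}x_{i_1}^{\gamma_1}\cdots x_{i_k}^{\gamma_k}$ for the composition $\gamma$ of $n$ with $S(\gamma)=T$. -}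

module Defs where

open import Data.Bool using (Bool; true; false; _∧_; not; if_then_else_; T; T?)
open import Data.Nat using (ℕ; zero; suc; _+_; _≡ᵇ_; _≤ᵇ_; _<ᵇ_) renaming (_≟_ to _≟ℕ_)
open import Data.Nat.Properties using (+-comm)
open import Data.Integer as ℤ using (ℤ)
open import Data.Fin using (Fin; toℕ; _↑ˡ_; _↑ʳ_; splitAt; cast)
  renaming (_≟_ to _≟ᶠ_)
open import Data.Vec using (Vec; lookup)
import Data.Vec as Vec
open import Data.Vec.Functional using () renaming (_∷_ to _∷ᶠ_)
open import Data.List using (List; []; _∷_; _++_; map; concatMap; filter; length; foldr; allFin)
open import Data.Bool.ListAction using (all; any)
import Data.List as List
open import Data.Sum using (inj₁; inj₂)
open import Data.Product using (_×_)
open import Relation.Nullary.Decidable using (⌊_⌋; ¬?)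
open import Relation.Binary.PropositionalEquality using (_≡_)
open import Relation.Binary.Structures using (IsPartialOrder)
open import Function.Definitions using (Bijective)

-- The underlying set of a poset with n elements is Fin n;
-- the order relation is given as a Boolean matrix (x ≤_P y iff le x y ≡ true)
-- and the labeling ω : Fin n → Fin n (labels 0..n-1 instead of 1..n; only
-- comparisons of labels matter).

record LPoset (n : ℕ) : Set where
  field
    le : Fin n → Fin n → Bool
    ω  : Fin n → Fin n
open LPoset public

IsLabeledPoset : ∀ {n} → LPoset n → Set
IsLabeledPoset P = IsPartialOrder _≡_ (λ x y → T (le P x y)) × Bijective _≡_ _≡_ (ω P)

sumLe : ∀ {m n} → (Fin m → Fin m → Bool) → (Fin n → Fin n → Bool) →
        Fin (m + n) → Fin (m + n) → Bool
sumLe {m} R S x y with splitAt m x | splitAt m y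
... | inj₁ a | inj₁ b = R a b
... | inj₁ a | inj₂ b = true
... | inj₂ a | inj₁ b = false
... | inj₂ a | inj₂ b = S a b

_↑P_ : ∀ {m n} → LPoset m → LPoset n → LPoset (m + n)
_↑P_ {m} {n} P Q = record
  { le = sumLe (le P) (le Q)
  ; ω  = λ x → lab (splitAt m x) }
  where
  lab : _ → Fin (m + n)
  lab (inj₁ a) = ω P a ↑ˡ n
  lab (inj₂ b) = m ↑ʳ ω Q b

-- strict ordinal sum: ω + |Q| on P, ω' on Q
_⇑P_ : ∀ {m n} → LPoset m → LPoset n → LPoset (m + n)
_⇑P_ {m} {n} P Q = record
  { le = sumLe (le P) (le Q)
  ; ω  = λ x → lab (splitAt m x) }
  where
  lab : _ → Fin (m + n)
  lab (inj₁ a) = cast (+-comm n m) (n ↑ʳ ω P a)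
  lab (inj₂ b) = cast (+-comm n m) (ω Q b ↑ˡ m)

-- Formal power series in x₁,x₂,… with integer coefficients: the coefficient
-- of the monomial x₁^{a₁}⋯x_k^{a_k} for every k and a : Vec ℕ k.

Series : Set
Series = (k : ℕ) → Vec ℕ k → ℤ

_≈ˢ_ : Series → Series → Set
s ≈ˢ t = ∀ k (a : Vec ℕ k) → s k a ≡ t k a

allFuns : (n k : ℕ) → List (Fin n → Fin k)
allFuns zero    k = (λ ()) ∷ []
allFuns (suc n) k = concatMap (λ i → map (λ g → i ∷ᶠ g) (allFuns n k)) (allFin k)

_==ᶠ_ : ∀ {n} → Fin n → Fin n → Bool
x ==ᶠ y = ⌊ x ≟ᶠ y ⌋

allᶠ : ∀ {n} → (Fin n → Bool) → Bool
allᶠ p = all p (allFin _)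

-- f : P → {1,…,k} (Fin k, value i standing for i+1) is a (P,ω)-partition:
-- a <_P b ⇒ f a ≤ f b, and moreover f a < f b if ω a > ω b.
isPPartition : ∀ {n k} → LPoset n → (Fin n → Fin k) → Bool
isPPartition P f = allᶠ λ a → allᶠ λ b →
  if le P a b ∧ not (a ==ᶠ b)
  then ((toℕ (f a) ≤ᵇ toℕ (f b)) ∧
        (if toℕ (ω P b) <ᵇ toℕ (ω P a) then toℕ (f a) <ᵇ toℕ (f b) else true))
  else true

hasContent : ∀ {n k} → (Fin n → Fin k) → Vec ℕ k → Bool
hasContent {n} {k} f a = allᶠ λ i →
  length (filter (λ x → f x ≟ᶠ i) (allFin n)) ≡ᵇ lookup a i

K : ∀ {n} → LPoset n → Series
K {n} P k a = ℤ.+ length (List.filter (λ f → T? (isPPartition P f ∧ hasContent f a)) (allFuns n k))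

incHead : List ℕ → List ℕ
incHead []       = []
incHead (x ∷ xs) = suc x ∷ xs

comps : ℕ → List (List ℕ)
comps zero          = [] ∷ []
comps (suc zero)    = (1 ∷ []) ∷ []
comps (suc (suc n)) = map (1 ∷_) (comps (suc n)) ++ map incHead (comps (suc n))

psums : ℕ → List ℕ → List ℕ
psums s []           = []
psums s (x ∷ [])     = []
psums s (x ∷ y ∷ ys) = (s + x) ∷ psums (s + x) (y ∷ ys)

S : List ℕ → List ℕ
S = psums 0

_⊆ᵇ_ : List ℕ → List ℕ → Bool
A ⊆ᵇ B = all (λ i → any (λ j → i ≡ᵇ j) B) A

_==ℓ_ : List ℕ → List ℕ → Bool
[]       ==ℓ []       = true
(x ∷ xs) ==ℓ (y ∷ ys) = (x ≡ᵇ y) ∧ (xs ==ℓ ys)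
_        ==ℓ _        = false

sumℕ : List ℕ → ℕ
sumℕ = foldr _+_ 0

sumℤ : List ℤ → ℤ
sumℤ = foldr ℤ._+_ (ℤ.+ 0)

nonzeros : ∀ {k} → Vec ℕ k → List ℕ
nonzeros a = filter (λ x → ¬? (x ≟ℕ 0)) (Vec.toList a)

M : List ℕ → Series
M γ k a = if nonzeros a ==ℓ γ then ℤ.+ 1 else ℤ.+ 0

F : List ℕ → Series
F α k a = sumℤ (map (λ γ → if S α ⊆ᵇ S γ then M γ k a else ℤ.+ 0) (comps (sumℕ α)))

_↑c_ : List ℕ → List ℕ → List ℕ
[]           ↑c β        = β
(x ∷ [])     ↑c []       = x ∷ []
(x ∷ [])     ↑c (y ∷ ys) = (x + y) ∷ ys
(x ∷ y ∷ xs) ↑c β        = x ∷ ((y ∷ xs) ↑c β)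

_⇑c_ : List ℕ → List ℕ → List ℕ
α ⇑c β = α ++ β

combo : ℕ → (List ℕ → ℤ) → Series
combo n c k a = sumℤ (map (λ α → c α ℤ.* F α k a) (comps n))

-- (Σ_{α⊨m} c(α) F_α) ⋆ (Σ_{β⊨n} d(β) F_β) = Σ_{α,β} c(α) d(β) F_{α ⋆ β},
-- for a product ⋆ defined on the F-basis by F_α ⋆ F_β = F_{α ⋆ β}
prodCombo : (List ℕ → List ℕ → List ℕ) → ℕ → ℕ → (List ℕ → ℤ) → (List ℕ → ℤ) → Series
prodCombo _⋆_ m n c d k a =
  sumℤ (map (λ α → sumℤ (map (λ β → (c α ℤ.* d β) ℤ.* F (α ⋆ β) k a) (comps n))) (comps m))

{-# OPTIONS --safe #-}
-- A (P ⋆ Q)-partition is a pair of a P-partition f and a Q-partition g with every value of f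
-- at most (for the strict sum: less than) every value of g. That condition depends only on the
-- contents u and v of f and g: it says that (u , v) is a weak (strict) splitting of u + v, u living
-- weakly (strictly) before v. So the x^a-coefficient of K_{P⋆Q} is the sum over the splittings
-- (u , v) of a of K_P(u) K_Q(v). This splitting sum is linear, and applied to F_α ⊗ F_β it gives
-- F_{α↑β} (F_{α⇑β}): a monomial of F_{α⋆β} is cut at the position where α ends, the coordinate
-- there being shared between the two factors in the weak case.
module Submission where

open import Defs
open import Data.Bool using (Bool; true; false; T; T?; if_then_else_; _∧_; _∨_; not)
open import Data.Bool.Properties using (∧-zeroʳ; ∧-identityʳ; ∧-assoc; ∨-zeroʳ; T-∧)
open import Data.Nat using (ℕ; zero; suc; _+_; _∸_; _<_; _≤_; _≡ᵇ_; _≤ᵇ_; _<ᵇ_; z≤n; z<s; s<s)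
import Data.Nat.Properties as ℕP
open import Data.Integer as ℤ using (ℤ; 0ℤ; 1ℤ; _*_) renaming (_+_ to _+ℤ_)
import Data.Integer.Properties as ℤP
open import Data.Integer.Tactic.RingSolver using (solve-∀)
open import Data.List as List using (List; []; _∷_; _++_; map; concatMap; filter; length; upTo)
open import Data.List.Properties using (map-applyUpTo)
open import Data.Bool.ListAction using (all; any)
open import Data.List.Relation.Unary.All using (All; []; _∷_)
import Data.List.Relation.Unary.All as All
import Data.List.Relation.Unary.All.Properties as All
open import Data.Product using (_×_; _,_; uncurry; proj₁; proj₂; ∃)
open import Data.Fin using (Fin; zero; suc; toℕ; _↑ˡ_; _↑ʳ_; splitAt) renaming (_≟_ to _≟ᶠ_)
import Data.Fin.Properties as FinP
open import Data.Vec.Functional using () renaming (_∷_ to _∷ᶠ_)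
open import Function.Bundles using (Equivalence)
open import Relation.Binary.PropositionalEquality
open import Relation.Binary.Definitions using (tri<; tri≈; tri>)
open import Data.Empty using (⊥-elim)
open import Data.Sum using (_⊎_; inj₁; inj₂; [_,_]′)
open import Function using (_∘_)
open import Relation.Nullary using (¬_; does; Dec; yes; no)
open import Relation.Nullary.Decidable using (dec-true)
open import Relation.Unary using (Decidable)
open import Data.Vec using (Vec; []; _∷_; replicate)
import Data.Vec as Vec
import Data.Vec.Properties as VecP

∑ : ∀ {A : Set} → (A → ℤ) → List A → ℤ
∑ f L = sumℤ (map f L)

module _ {A : Set} where

  ∑-cong : ∀ {f g : A → ℤ} L → (∀ x → f x ≡ g x) → ∑ f L ≡ ∑ g L
  ∑-cong []      f≗g = refl
  ∑-cong (x ∷ L) f≗g = cong₂ _+ℤ_ (f≗g x) (∑-cong L f≗g)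

  ∑-congᴬ : ∀ {P : A → Set} {f g : A → ℤ} {L} → All P L → (∀ x → P x → f x ≡ g x) → ∑ f L ≡ ∑ g L
  ∑-congᴬ []         f≗g = refl
  ∑-congᴬ (px ∷ pxs) f≗g = cong₂ _+ℤ_ (f≗g _ px) (∑-congᴬ pxs f≗g)

  ∑-zero : ∀ L → ∑ {A} (λ _ → 0ℤ) L ≡ 0ℤ
  ∑-zero []      = refl
  ∑-zero (x ∷ L) = trans (ℤP.+-identityˡ _) (∑-zero L)

  ∑-vanishing : ∀ {P : A → Set} {f : A → ℤ} {L} → All P L → (∀ x → P x → f x ≡ 0ℤ) → ∑ f L ≡ 0ℤ
  ∑-vanishing {L = L} pL f≡0 = trans (∑-congᴬ pL f≡0) (∑-zero L)

  ∑-+ : ∀ (f g : A → ℤ) L → ∑ (λ x → f x +ℤ g x) L ≡ ∑ f L +ℤ ∑ g L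
  ∑-+ f g []      = refl
  ∑-+ f g (x ∷ L) rewrite ∑-+ f g L = interchange (f x) (g x) (∑ f L) (∑ g L)
    where
    interchange : ∀ a b c d → (a +ℤ b) +ℤ (c +ℤ d) ≡ (a +ℤ c) +ℤ (b +ℤ d)
    interchange = solve-∀

  ∑-*ˡ : ∀ c (f : A → ℤ) L → ∑ (λ x → c * f x) L ≡ c * ∑ f L
  ∑-*ˡ c f []      = sym (ℤP.*-zeroʳ c)
  ∑-*ˡ c f (x ∷ L) rewrite ∑-*ˡ c f L = sym (ℤP.*-distribˡ-+ c (f x) (∑ f L))

  ∑-++ : ∀ (f : A → ℤ) L L' → ∑ f (L ++ L') ≡ ∑ f L +ℤ ∑ f L'
  ∑-++ f []      L' = sym (ℤP.+-identityˡ _)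
  ∑-++ f (x ∷ L) L' rewrite ∑-++ f L L' = sym (ℤP.+-assoc (f x) (∑ f L) (∑ f L'))

∑-map : ∀ {A B : Set} (f : B → ℤ) (g : A → B) L → ∑ f (map g L) ≡ ∑ (λ x → f (g x)) L
∑-map f g []      = refl
∑-map f g (x ∷ L) = cong (f (g x) +ℤ_) (∑-map f g L)

∑-concatMap : ∀ {A B : Set} (f : B → ℤ) (g : A → List B) L →
              ∑ f (concatMap g L) ≡ ∑ (λ x → ∑ f (g x)) L
∑-concatMap f g []      = refl
∑-concatMap f g (x ∷ L) =
  trans (∑-++ f (g x) (concatMap g L)) (cong (∑ f (g x) +ℤ_) (∑-concatMap f g L))

∑-comm : ∀ {A B : Set} (f : A → B → ℤ) L L' →
         ∑ (λ x → ∑ (f x) L') L ≡ ∑ (λ y → ∑ (λ x → f x y) L) L'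
∑-comm f []      L' = sym (∑-zero L')
∑-comm f (x ∷ L) L' rewrite ∑-comm f L L' = sym (∑-+ (f x) (λ y → ∑ (λ x → f x y) L) L')

∑-*-∑ : ∀ {A B : Set} (f : A → ℤ) (g : B → ℤ) L L' →
        ∑ f L * ∑ g L' ≡ ∑ (λ x → ∑ (λ y → f x * g y) L') L
∑-*-∑ f g L L' = begin
  ∑ f L * ∑ g L'                    ≡⟨ ℤP.*-comm (∑ f L) (∑ g L') ⟩
  ∑ g L' * ∑ f L                    ≡⟨ ∑-*ˡ (∑ g L') f L ⟨
  ∑ (λ x → ∑ g L' * f x) L          ≡⟨ ∑-cong L (λ x → ℤP.*-comm (∑ g L') (f x)) ⟩
  ∑ (λ x → f x * ∑ g L') L          ≡⟨ ∑-cong L (λ x → ∑-*ˡ (f x) g L') ⟨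
  ∑ (λ x → ∑ (λ y → f x * g y) L') L ∎
  where open ≡-Reasoning

∑-upTo-suc : ∀ (f : ℕ → ℤ) x → ∑ f (upTo (suc x)) ≡ f 0 +ℤ ∑ (λ t → f (suc t)) (upTo x)
∑-upTo-suc f x = cong (λ L → f 0 +ℤ sumℤ L)
  (trans (map-applyUpTo suc f x) (sym (map-applyUpTo (λ t → t) (λ t → f (suc t)) x)))

∑-upTo-single : ∀ (f : ℕ → ℤ) {p x} → p < x → (∀ t → t ≢ p → f t ≡ 0ℤ) → ∑ f (upTo x) ≡ f p
∑-upTo-single f {zero} {suc x} _ f≡0 = begin
  ∑ f (upTo (suc x))
    ≡⟨ ∑-upTo-suc f x ⟩
  f 0 +ℤ ∑ (λ t → f (suc t)) (upTo x)
    ≡⟨ cong (f 0 +ℤ_) (trans (∑-cong (upTo x) (λ t → f≡0 (suc t) λ ())) (∑-zero (upTo x))) ⟩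
  f 0 +ℤ 0ℤ
    ≡⟨ ℤP.+-identityʳ (f 0) ⟩
  f 0 ∎
  where open ≡-Reasoning
∑-upTo-single f {suc p} {suc x} (s<s p<x) f≡0 = begin
  ∑ f (upTo (suc x))
    ≡⟨ ∑-upTo-suc f x ⟩
  f 0 +ℤ ∑ (λ t → f (suc t)) (upTo x)
    ≡⟨ cong₂ _+ℤ_ (f≡0 0 λ ())
                  (∑-upTo-single (λ t → f (suc t)) p<x (λ t t≢p → f≡0 (suc t) (t≢p ∘ ℕP.suc-injective))) ⟩
  0ℤ +ℤ f (suc p)
    ≡⟨ ℤP.+-identityˡ (f (suc p)) ⟩
  f (suc p) ∎
  where open ≡-Reasoning

𝟙 : Bool → ℤ
𝟙 b = if b then 1ℤ else 0ℤ

𝟙-∧ : ∀ a b → 𝟙 (a ∧ b) ≡ 𝟙 a * 𝟙 b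
𝟙-∧ true  b = sym (ℤP.*-identityˡ (𝟙 b))
𝟙-∧ false b = sym (ℤP.*-zeroˡ (𝟙 b))

length-filter≡∑𝟙 : ∀ {A : Set} (b : A → Bool) L →
                   ℤ.+ length (filter (λ x → T? (b x)) L) ≡ ∑ (λ x → 𝟙 (b x)) L
length-filter≡∑𝟙 b []      = refl
length-filter≡∑𝟙 b (x ∷ L) with b x
... | true  = cong (1ℤ +ℤ_) (length-filter≡∑𝟙 b L)
... | false = trans (length-filter≡∑𝟙 b L) (sym (ℤP.+-identityˡ _))

T⇒≡true : ∀ {b} → T b → b ≡ true
T⇒≡true {true} _ = refl

¬T⇒≡false : ∀ {b} → ¬ T b → b ≡ false
¬T⇒≡false {false} _  = refl
¬T⇒≡false {true}  ¬t = ⊥-elim (¬t _)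

≡ᵇ-refl : ∀ x → (x ≡ᵇ x) ≡ true
≡ᵇ-refl x = T⇒≡true (ℕP.≡⇒≡ᵇ x x refl)

≡ᵇ-≢ : ∀ {x y} → x ≢ y → (x ≡ᵇ y) ≡ false
≡ᵇ-≢ x≢y = ¬T⇒≡false (λ t → x≢y (ℕP.≡ᵇ⇒≡ _ _ t))

<ᵇ-< : ∀ {x y} → x < y → (x <ᵇ y) ≡ true
<ᵇ-< x<y = T⇒≡true (ℕP.<⇒<ᵇ x<y)

<ᵇ-≥ : ∀ {x y} → y ≤ x → (x <ᵇ y) ≡ false
<ᵇ-≥ y≤x = ¬T⇒≡false (λ t → ℕP.<⇒≱ (ℕP.<ᵇ⇒< _ _ t) y≤x)

∧-congʳ-T : ∀ b {c c'} → (T b → c ≡ c') → (b ∧ c) ≡ (b ∧ c')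
∧-congʳ-T true  c≡c' = c≡c' _
∧-congʳ-T false _    = refl

≡ᵇ-+ˡ : ∀ x a b → (x + a ≡ᵇ x + b) ≡ (a ≡ᵇ b)
≡ᵇ-+ˡ zero    a b = refl
≡ᵇ-+ˡ (suc x) a b = ≡ᵇ-+ˡ x a b

<ᵇ-+ˡ : ∀ c x y → (c + x <ᵇ c + y) ≡ (x <ᵇ y)
<ᵇ-+ˡ zero    x y = refl
<ᵇ-+ˡ (suc c) x y = <ᵇ-+ˡ c x y

T-injective : ∀ {a b} → (T a → T b) → (T b → T a) → a ≡ b
T-injective {false} {false} _ _ = refl
T-injective {false} {true}  _ b⇒a = ⊥-elim (b⇒a _)
T-injective {true}  {false} a⇒b _ = ⊥-elim (a⇒b _)
T-injective {true}  {true}  _ _ = refl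

does⇒ : ∀ {A : Set} (d : Dec A) → does d ≡ true → A
does⇒ (yes a) _ = a

-- Compositions

positive : List ℕ → Bool
positive []          = true
positive (zero  ∷ α) = false
positive (suc _ ∷ α) = positive α

Positive : List ℕ → Set
Positive α = T (positive α)

positive-nonzeros : ∀ {k} (a : Vec ℕ k) → positive (nonzeros a) ≡ true
positive-nonzeros []          = refl
positive-nonzeros (zero  ∷ a) = positive-nonzeros a
positive-nonzeros (suc _ ∷ a) = positive-nonzeros a

positive-∷ : ∀ {p} α → 0 < p → Positive α → Positive (p ∷ α)
positive-∷ {suc p} α _ pα = pα

positive-∸∷ : ∀ {x p} α → x < p → Positive α → Positive ((p ∸ x) ∷ α)
positive-∸∷ α x<p = positive-∷ α (ℕP.m<n⇒0<n∸m x<p)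

positive-head : ∀ p α → Positive (p ∷ α) → 0 < p
positive-head (suc p) α _ = z<s

positive-tail : ∀ p α → Positive (p ∷ α) → Positive α
positive-tail (suc p) α pα = pα

positive-↑c : ∀ α β → Positive α → Positive β → Positive (α ↑c β)
positive-↑c []                  β           _  pβ = pβ
positive-↑c (suc p ∷ [])        []          _  _  = _
positive-↑c (suc p ∷ [])        (suc q ∷ β) _  pβ = pβ
positive-↑c (suc p ∷ q ∷ α)     β           pα pβ = positive-↑c (q ∷ α) β pα pβ

positive-++ : ∀ α β → Positive α → Positive β → Positive (α ++ β)
positive-++ []          β _  pβ = pβ
positive-++ (suc p ∷ α) β pα pβ = positive-++ α β pα pβ

comps-positive : ∀ N → All Positive (comps N)
comps-positive zero          = _ ∷ []
comps-positive (suc zero)    = _ ∷ []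
comps-positive (suc (suc n)) =
  All.++⁺ (All.map⁺ (comps-positive (suc n))) (All.map⁺ (All.map (λ {γ} → incHead-positive {γ}) (comps-positive (suc n))))
  where
  incHead-positive : ∀ {γ} → Positive γ → Positive (incHead γ)
  incHead-positive {[]}        p = p
  incHead-positive {suc _ ∷ γ} p = p

==ℓ-incHead-suc : ∀ y δ γ → ((suc y ∷ δ) ==ℓ incHead γ) ≡ ((y ∷ δ) ==ℓ γ)
==ℓ-incHead-suc y δ []      = refl
==ℓ-incHead-suc y δ (_ ∷ γ) = refl

==ℓ-incHead-[] : ∀ γ → ([] ==ℓ incHead γ) ≡ ([] ==ℓ γ)
==ℓ-incHead-[] []      = refl
==ℓ-incHead-[] (_ ∷ γ) = refl

==ℓ-incHead-zero : ∀ δ γ → ((zero ∷ δ) ==ℓ incHead γ) ≡ false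
==ℓ-incHead-zero δ []      = refl
==ℓ-incHead-zero δ (_ ∷ γ) = refl

multiplicity : ℕ → List ℕ → ℤ
multiplicity N δ = ∑ (λ γ → 𝟙 (δ ==ℓ γ)) (comps N)

MultiplicityFormula : ℕ → Set
MultiplicityFormula N = ∀ δ → multiplicity N δ ≡ 𝟙 (positive δ ∧ (sumℕ δ ≡ᵇ N))

multiplicity-step : ∀ n → MultiplicityFormula (suc n) → MultiplicityFormula (suc (suc n))
multiplicity-step n IH δ = begin
  multiplicity (suc (suc n)) δ
    ≡⟨ ∑-++ _ (map (1 ∷_) C) (map incHead C) ⟩
  ∑ _ (map (1 ∷_) C) +ℤ ∑ _ (map incHead C)
    ≡⟨ cong₂ _+ℤ_ (∑-map _ (1 ∷_) C) (∑-map _ incHead C) ⟩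
  ∑ (λ γ → 𝟙 (δ ==ℓ (1 ∷ γ))) C +ℤ ∑ (λ γ → 𝟙 (δ ==ℓ incHead γ)) C
    ≡⟨ split δ ⟩
  𝟙 (positive δ ∧ (sumℕ δ ≡ᵇ suc (suc n))) ∎
  where
  open ≡-Reasoning
  C = comps (suc n)
  split : ∀ δ → ∑ (λ γ → 𝟙 (δ ==ℓ (1 ∷ γ))) C +ℤ ∑ (λ γ → 𝟙 (δ ==ℓ incHead γ)) C
                ≡ 𝟙 (positive δ ∧ (sumℕ δ ≡ᵇ suc (suc n)))
  split []                = cong₂ _+ℤ_ (∑-zero C) (trans (∑-cong C (λ γ → cong 𝟙 (==ℓ-incHead-[] γ))) (IH []))
  split (zero ∷ δ)        = cong₂ _+ℤ_ (∑-zero C) (trans (∑-cong C (λ γ → cong 𝟙 (==ℓ-incHead-zero δ γ))) (∑-zero C))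
  split (1 ∷ δ)           = trans (cong₂ _+ℤ_ (IH δ) (trans (∑-cong C (λ γ → cong 𝟙 (==ℓ-incHead-suc 0 δ γ))) (IH (0 ∷ δ))))
                                  (ℤP.+-identityʳ _)
  split (suc (suc y) ∷ δ) =
    trans (cong₂ _+ℤ_ (∑-zero C) (trans (∑-cong C (λ γ → cong 𝟙 (==ℓ-incHead-suc (suc y) δ γ))) (IH (suc y ∷ δ))))
          (ℤP.+-identityˡ _)

comps-multiplicity : ∀ N → MultiplicityFormula N
comps-multiplicity zero          []                = refl
comps-multiplicity zero          (zero  ∷ δ)       = refl
comps-multiplicity zero          (suc _ ∷ δ)       = cong 𝟙 (sym (∧-zeroʳ (positive δ)))
comps-multiplicity (suc zero)    []                = refl
comps-multiplicity (suc zero)    (zero ∷ δ)        = refl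
comps-multiplicity (suc zero)    (1 ∷ [])          = refl
comps-multiplicity (suc zero)    (1 ∷ zero ∷ δ)    = refl
comps-multiplicity (suc zero)    (1 ∷ suc _ ∷ δ)   = cong 𝟙 (sym (∧-zeroʳ (positive δ)))
comps-multiplicity (suc zero)    (suc (suc _) ∷ δ) = cong 𝟙 (sym (∧-zeroʳ (positive δ)))
comps-multiplicity (suc (suc n)) = multiplicity-step n (comps-multiplicity (suc n))

-- Fundamental quasisymmetric functions

-- fcoeff α δ is the coefficient of M_δ in F_α: it is 1 exactly when the composition δ refines α.
fcoeff : List ℕ → List ℕ → ℤ
fcoeff []      []      = 1ℤ
fcoeff (_ ∷ _) []      = 0ℤ
fcoeff []      (_ ∷ _) = 0ℤ
fcoeff (p ∷ α) (x ∷ δ) = if x <ᵇ p then fcoeff ((p ∸ x) ∷ α) δ else if x ≡ᵇ p then fcoeff α δ else 0ℤ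

fcoeff-< : ∀ {x p} α δ → x < p → fcoeff (p ∷ α) (x ∷ δ) ≡ fcoeff ((p ∸ x) ∷ α) δ
fcoeff-< α δ x<p rewrite <ᵇ-< x<p = refl

fcoeff-≡ : ∀ p α δ → fcoeff (p ∷ α) (p ∷ δ) ≡ fcoeff α δ
fcoeff-≡ p α δ rewrite <ᵇ-≥ (ℕP.≤-refl {p}) | ≡ᵇ-refl p = refl

fcoeff-> : ∀ {x p} α δ → p < x → fcoeff (p ∷ α) (x ∷ δ) ≡ 0ℤ
fcoeff-> α δ p<x rewrite <ᵇ-≥ (ℕP.<⇒≤ p<x) | ≡ᵇ-≢ (ℕP.>⇒≢ p<x) = refl

fcoeff-+ : ∀ p q y α δ → fcoeff ((p + q) ∷ α) ((p + y) ∷ δ) ≡ fcoeff (q ∷ α) (y ∷ δ)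
fcoeff-+ p q y α δ with ℕP.<-cmp y q
... | tri< y<q _ _ rewrite fcoeff-< α δ y<q | fcoeff-< α δ (ℕP.+-monoʳ-< p y<q) | ℕP.[m+n]∸[m+o]≡n∸o p q y = refl
... | tri≈ _ refl _ = trans (fcoeff-≡ (p + y) α δ) (sym (fcoeff-≡ y α δ))
... | tri> _ _ q<y rewrite fcoeff-> α δ q<y | fcoeff-> α δ (ℕP.+-monoʳ-< p q<y) = refl

_⊑_ : List ℕ → List ℕ → Bool
δ ⊑ α = (sumℕ δ ≡ᵇ sumℕ α) ∧ (S α ⊆ᵇ S δ)

psums-+ : ∀ s t l → psums (s + t) l ≡ map (s +_) (psums t l)
psums-+ s t []           = refl
psums-+ s t (x ∷ [])     = refl
psums-+ s t (x ∷ y ∷ ys) =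
  cong₂ _∷_ (ℕP.+-assoc s t x)
            (trans (cong (λ z → psums z (y ∷ ys)) (ℕP.+-assoc s t x)) (psums-+ s (t + x) (y ∷ ys)))

S-∷ : ∀ x y ys → S (x ∷ y ∷ ys) ≡ x ∷ map (x +_) (S (y ∷ ys))
S-∷ x y ys = cong (x ∷_) (trans (cong (λ z → psums z (y ∷ ys)) (sym (ℕP.+-identityʳ x))) (psums-+ x 0 (y ∷ ys)))

S-+ : ∀ x d l → S ((x + d) ∷ l) ≡ map (x +_) (S (d ∷ l))
S-+ x d []      = refl
S-+ x d (q ∷ l) = cong ((x + d) ∷_) (psums-+ x d (q ∷ l))

S-positive : ∀ α → Positive α → All (0 <_) (S α)
S-positive []              _ = []
S-positive (x ∷ [])        _ = []
S-positive (suc x ∷ y ∷ α) p rewrite S-∷ (suc x) y α =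
  z<s ∷ All.map⁺ (All.universal (λ z → ℕP.<-≤-trans z<s (ℕP.m≤m+n (suc x) z)) _)

any-+ : ∀ x l B → any (λ j → (x + l) ≡ᵇ j) (map (x +_) B) ≡ any (λ j → l ≡ᵇ j) B
any-+ x l []      = refl
any-+ x l (b ∷ B) = cong₂ _∨_ (≡ᵇ-+ˡ x l b) (any-+ x l B)

any-below : ∀ {p x} B → p < x → any (λ j → p ≡ᵇ j) (map (x +_) B) ≡ false
any-below []      p<x = refl
any-below {x = x} (b ∷ B) p<x
  rewrite ≡ᵇ-≢ (ℕP.<⇒≢ (ℕP.<-≤-trans p<x (ℕP.m≤m+n x b))) = any-below B p<x

map-+-⊆ᵇ : ∀ x L B → All (0 <_) L → (map (x +_) L ⊆ᵇ (x ∷ map (x +_) B)) ≡ (L ⊆ᵇ B)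
map-+-⊆ᵇ x []      B _           = refl
map-+-⊆ᵇ x (l ∷ L) B (0<l ∷ 0<L)
  rewrite ≡ᵇ-≢ (ℕP.>⇒≢ (ℕP.m<m+n x 0<l)) | any-+ x l B | map-+-⊆ᵇ x L B 0<L = refl

∷-map-+-⊆ᵇ : ∀ x L B → All (0 <_) L → ((x ∷ map (x +_) L) ⊆ᵇ (x ∷ map (x +_) B)) ≡ (L ⊆ᵇ B)
∷-map-+-⊆ᵇ x L B 0<L rewrite ≡ᵇ-refl x = map-+-⊆ᵇ x L B 0<L

⊑-< : ∀ x d α δ → 0 < d → Positive α → ((x ∷ δ) ⊑ ((x + d) ∷ α)) ≡ (δ ⊑ (d ∷ α))
⊑-< x d α δ 0<d pα rewrite ℕP.+-assoc x d (sumℕ α) | ≡ᵇ-+ˡ x (sumℕ δ) (d + sumℕ α) =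
  ∧-congʳ-T (sumℕ δ ≡ᵇ (d + sumℕ α)) (subsets δ)
  where
  subsets : ∀ δ → T (sumℕ δ ≡ᵇ (d + sumℕ α)) → (S ((x + d) ∷ α) ⊆ᵇ S (x ∷ δ)) ≡ (S (d ∷ α) ⊆ᵇ S δ)
  subsets []      t = ⊥-elim (ℕP.<⇒≢ (ℕP.<-≤-trans 0<d (ℕP.m≤m+n d (sumℕ α))) (ℕP.≡ᵇ⇒≡ 0 _ t))
  subsets (y ∷ δ) _ = trans (cong₂ _⊆ᵇ_ (S-+ x d α) (S-∷ x y δ))
                            (map-+-⊆ᵇ x (S (d ∷ α)) (S (y ∷ δ)) (S-positive (d ∷ α) (positive-∷ α 0<d pα)))

⊑-≡ : ∀ p α δ → Positive α → ((p ∷ δ) ⊑ (p ∷ α)) ≡ (δ ⊑ α)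
⊑-≡ p α δ pα rewrite ≡ᵇ-+ˡ p (sumℕ δ) (sumℕ α) = ∧-congʳ-T (sumℕ δ ≡ᵇ sumℕ α) (subsets α δ pα)
  where
  subsets : ∀ α δ → Positive α → T (sumℕ δ ≡ᵇ sumℕ α) → (S (p ∷ α) ⊆ᵇ S (p ∷ δ)) ≡ (S α ⊆ᵇ S δ)
  subsets []          δ       _  _ = refl
  subsets (suc q ∷ α) []      pα ()
  subsets (suc q ∷ α) (y ∷ δ) pα _ = trans (cong₂ _⊆ᵇ_ (S-∷ p (suc q) α) (S-∷ p y δ))
    (∷-map-+-⊆ᵇ p (S (suc q ∷ α)) (S (y ∷ δ)) (S-positive (suc q ∷ α) pα))

⊑-> : ∀ {p x} α δ → p < x → ((x ∷ δ) ⊑ (p ∷ α)) ≡ false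
⊑-> {p} {x} []      δ       p<x
  rewrite ℕP.+-identityʳ p | ≡ᵇ-≢ (ℕP.>⇒≢ (ℕP.<-≤-trans p<x (ℕP.m≤m+n x (sumℕ δ)))) = refl
⊑-> {p} {x} (q ∷ α) [] p<x = ∧-zeroʳ (x + 0 ≡ᵇ p + sumℕ (q ∷ α))
⊑-> {p} {x} (q ∷ α) (y ∷ δ) p<x =
  trans (cong ((sumℕ (x ∷ y ∷ δ) ≡ᵇ sumℕ (p ∷ q ∷ α)) ∧_)
              (trans (cong₂ _⊆ᵇ_ (S-∷ p q α) (S-∷ x y δ)) (head-missing (S (y ∷ δ)))))
        (∧-zeroʳ (sumℕ (x ∷ y ∷ δ) ≡ᵇ sumℕ (p ∷ q ∷ α)))
  where
  head-missing : ∀ B → ((p ∷ map (p +_) (S (q ∷ α))) ⊆ᵇ (x ∷ map (x +_) B)) ≡ false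
  head-missing B rewrite ≡ᵇ-≢ (ℕP.<⇒≢ p<x) | any-below B p<x = refl

𝟙-⊑ : ∀ α δ → Positive α → Positive δ → 𝟙 (δ ⊑ α) ≡ fcoeff α δ
𝟙-⊑ []          []          _  _  = refl
𝟙-⊑ (suc p ∷ α) []          _  _  = refl
𝟙-⊑ []          (suc x ∷ δ) _  _  = refl
𝟙-⊑ (suc p ∷ α) (suc x ∷ δ) pα pδ with ℕP.<-cmp (suc x) (suc p)
... | tri< x<p _ _ = begin
  𝟙 ((suc x ∷ δ) ⊑ (suc p ∷ α))                  ≡⟨ cong (λ z → 𝟙 ((suc x ∷ δ) ⊑ (z ∷ α))) (ℕP.m+[n∸m]≡n (ℕP.<⇒≤ x<p)) ⟨
  𝟙 ((suc x ∷ δ) ⊑ ((suc x + (p ∸ x)) ∷ α))      ≡⟨ cong 𝟙 (⊑-< (suc x) (suc p ∸ suc x) α δ (ℕP.m<n⇒0<n∸m x<p) pα) ⟩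
  𝟙 (δ ⊑ ((p ∸ x) ∷ α))                          ≡⟨ 𝟙-⊑ ((suc p ∸ suc x) ∷ α) δ (positive-∸∷ α x<p pα) pδ ⟩
  fcoeff ((p ∸ x) ∷ α) δ                         ≡⟨ fcoeff-< α δ x<p ⟨
  fcoeff (suc p ∷ α) (suc x ∷ δ)                 ∎
  where open ≡-Reasoning
... | tri≈ _ refl _ = trans (cong 𝟙 (⊑-≡ (suc p) α δ pα)) (trans (𝟙-⊑ α δ pα pδ) (sym (fcoeff-≡ (suc p) α δ)))
... | tri> _ _ p<x = trans (cong 𝟙 (⊑-> α δ p<x)) (sym (fcoeff-> α δ p<x))

==ℓ⇒≡ : ∀ δ γ → (δ ==ℓ γ) ≡ true → δ ≡ γ
==ℓ⇒≡ []      []      _ = refl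
==ℓ⇒≡ (x ∷ δ) (y ∷ γ) e with x ≡ᵇ y in x≡ᵇy | δ ==ℓ γ in δ==γ
... | true | true = cong₂ _∷_ (ℕP.≡ᵇ⇒≡ x y (subst T (sym x≡ᵇy) _)) (==ℓ⇒≡ δ γ δ==γ)

guard-as-factor : ∀ e c c' → (e ≡ true → c ≡ c') → (if c then 𝟙 e else 0ℤ) ≡ 𝟙 c' * 𝟙 e
guard-as-factor false c c' _ = trans (if-same c) (sym (ℤP.*-zeroʳ (𝟙 c')))
  where
  if-same : ∀ c → (if c then 0ℤ else 0ℤ) ≡ 0ℤ
  if-same true  = refl
  if-same false = refl
guard-as-factor true c c' c≡c' rewrite c≡c' refl = sym (ℤP.*-identityʳ (𝟙 c'))

F≡fcoeff : ∀ α → Positive α → ∀ k (a : Vec ℕ k) → F α k a ≡ fcoeff α (nonzeros a)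
F≡fcoeff α pα k a = begin
  F α k a
    ≡⟨ ∑-cong (comps ∣α∣) (λ γ → guard-as-factor (δ ==ℓ γ) (S α ⊆ᵇ S γ) (S α ⊆ᵇ S δ)
                                   (λ δ==γ → cong (λ z → S α ⊆ᵇ S z) (sym (==ℓ⇒≡ δ γ δ==γ)))) ⟩
  ∑ (λ γ → 𝟙 (S α ⊆ᵇ S δ) * 𝟙 (δ ==ℓ γ)) (comps ∣α∣)
    ≡⟨ ∑-*ˡ (𝟙 (S α ⊆ᵇ S δ)) (λ γ → 𝟙 (δ ==ℓ γ)) (comps ∣α∣) ⟩
  𝟙 (S α ⊆ᵇ S δ) * multiplicity ∣α∣ δ
    ≡⟨ cong (𝟙 (S α ⊆ᵇ S δ) *_) (comps-multiplicity ∣α∣ δ) ⟩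
  𝟙 (S α ⊆ᵇ S δ) * 𝟙 (positive δ ∧ (sumℕ δ ≡ᵇ ∣α∣))
    ≡⟨ cong (λ b → 𝟙 (S α ⊆ᵇ S δ) * 𝟙 (b ∧ (sumℕ δ ≡ᵇ ∣α∣))) (positive-nonzeros a) ⟩
  𝟙 (S α ⊆ᵇ S δ) * 𝟙 (sumℕ δ ≡ᵇ ∣α∣)
    ≡⟨ ℤP.*-comm (𝟙 (S α ⊆ᵇ S δ)) _ ⟩
  𝟙 (sumℕ δ ≡ᵇ ∣α∣) * 𝟙 (S α ⊆ᵇ S δ)
    ≡⟨ 𝟙-∧ (sumℕ δ ≡ᵇ ∣α∣) (S α ⊆ᵇ S δ) ⟨
  𝟙 (δ ⊑ α)
    ≡⟨ 𝟙-⊑ α δ pα (subst T (sym (positive-nonzeros a)) _) ⟩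
  fcoeff α δ ∎
  where
  open ≡-Reasoning
  ∣α∣ = sumℕ α
  δ = nonzeros a

-- Splittings of exponent vectors

zeros : ∀ {k} → Vec ℕ k
zeros = replicate _ 0

_+v_ : ∀ {k} → Vec ℕ k → Vec ℕ k → Vec ℕ k
_+v_ = Vec.zipWith _+_

zeros-+v : ∀ {k} (v : Vec ℕ k) → zeros +v v ≡ v
zeros-+v []      = refl
zeros-+v (x ∷ v) = cong (x ∷_) (zeros-+v v)

_==v_ : ∀ {k} → Vec ℕ k → Vec ℕ k → Bool
[]      ==v []      = true
(x ∷ u) ==v (y ∷ v) = (x ≡ᵇ y) ∧ (u ==v v)

==v⇒≡ : ∀ {k} (u v : Vec ℕ k) → (u ==v v) ≡ true → u ≡ v
==v⇒≡ []      []      _ = refl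
==v⇒≡ (x ∷ u) (y ∷ v) e with x ≡ᵇ y in x≡ᵇy | u ==v v in u==v
... | true | true = cong₂ _∷_ (ℕP.≡ᵇ⇒≡ x y (subst T (sym x≡ᵇy) _)) (==v⇒≡ u v u==v)

==v-refl : ∀ {k} (u : Vec ℕ k) → (u ==v u) ≡ true
==v-refl []      = refl
==v-refl (x ∷ u) rewrite ≡ᵇ-refl x = ==v-refl u

-- In a splitting (u , v) of a, the first nonzero coordinate x of v may be shared with u
-- (weak, s = false: u takes t < x of it) or not (strict, s = true); all later coordinates
-- belong to v and all earlier ones to u.
cutShares : Bool → ℕ → List ℕ
cutShares false x       = upTo x
cutShares true  zero    = []
cutShares true  (suc _) = 0 ∷ []

cutShares-< : ∀ s x → All (_< x) (cutShares s x)
cutShares-< false x       = All.applyUpTo⁺₁ (λ t → t) x (λ t<x → t<x)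
cutShares-< true  zero    = []
cutShares-< true  (suc _) = z<s ∷ []

Splitting : ℕ → Set
Splitting k = Vec ℕ k × Vec ℕ k

splittings : Bool → ∀ {k} → Vec ℕ k → List (Splitting k)
splittings s []      = ([] , []) ∷ []
splittings s (x ∷ a) = map (λ (u , v) → (x ∷ u , 0 ∷ v)) (splittings s a)
                    ++ map (λ t → (t ∷ zeros , (x ∸ t) ∷ a)) (cutShares s x)

splitSum : Bool → ∀ {k} → Vec ℕ k → (Vec ℕ k → Vec ℕ k → ℤ) → ℤ
splitSum s a h = ∑ (uncurry h) (splittings s a)

splitSum-∷ : ∀ s {k} x (a : Vec ℕ k) h →
  splitSum s (x ∷ a) h ≡ splitSum s a (λ u v → h (x ∷ u) (0 ∷ v)) +ℤ ∑ (λ t → h (t ∷ zeros) ((x ∸ t) ∷ a)) (cutShares s x)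
splitSum-∷ s x a h = begin
  splitSum s (x ∷ a) h
    ≡⟨ ∑-++ (uncurry h) (map _ (splittings s a)) (map _ (cutShares s x)) ⟩
  ∑ (uncurry h) (map _ (splittings s a)) +ℤ ∑ (uncurry h) (map _ (cutShares s x))
    ≡⟨ cong₂ _+ℤ_ (∑-map (uncurry h) _ (splittings s a)) (∑-map (uncurry h) _ (cutShares s x)) ⟩
  splitSum s a (λ u v → h (x ∷ u) (0 ∷ v)) +ℤ ∑ (λ t → h (t ∷ zeros) ((x ∸ t) ∷ a)) (cutShares s x) ∎
  where open ≡-Reasoning

module _ (s : Bool) {k} (a : Vec ℕ k) where

  splitSum-cong : ∀ {h h'} → (∀ u v → h u v ≡ h' u v) → splitSum s a h ≡ splitSum s a h'
  splitSum-cong h≗h' = ∑-cong (splittings s a) (λ (u , v) → h≗h' u v)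

  splitSum-zero : ∀ {h} → (∀ u v → h u v ≡ 0ℤ) → splitSum s a h ≡ 0ℤ
  splitSum-zero h≡0 = trans (splitSum-cong h≡0) (∑-zero (splittings s a))

  splitSum-*ˡ : ∀ c h → splitSum s a (λ u v → c * h u v) ≡ c * splitSum s a h
  splitSum-*ˡ c h = ∑-*ˡ c (uncurry h) (splittings s a)

  splitSum-∑ : ∀ {A : Set} (f : A → Vec ℕ k → Vec ℕ k → ℤ) L →
               splitSum s a (λ u v → ∑ (λ i → f i u v) L) ≡ ∑ (λ i → splitSum s a (f i)) L
  splitSum-∑ f L = ∑-comm (λ (u , v) i → f i u v) (splittings s a) L

cutAllowed : Bool → ℕ → Bool
cutAllowed false _ = true
cutAllowed true  i = i ≡ᵇ 0

-- separated s u v: wherever v is nonzero, u vanishes strictly after (s = false) or from there on (s = true).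
separated : Bool → ∀ {k} → Vec ℕ k → Vec ℕ k → Bool
separated s []      []      = true
separated s (i ∷ u) (j ∷ v) = ((j ≡ᵇ 0) ∨ (cutAllowed s i ∧ (u ==v zeros))) ∧ separated s u v

separated-zeros : ∀ s {k} (v : Vec ℕ k) → separated s zeros v ≡ true
separated-zeros s []      = refl
separated-zeros s (j ∷ v) rewrite ==v-refl (zeros {Vec.length v}) | separated-zeros s v = head-holds s
  where
  head-holds : ∀ s → ((j ≡ᵇ 0) ∨ (cutAllowed s 0 ∧ true)) ∧ true ≡ true
  head-holds false = trans (∧-identityʳ _) (∨-zeroʳ _)
  head-holds true  = trans (∧-identityʳ _) (∨-zeroʳ _)

cutShares-select : ∀ s x i j → 0 < j →
  ∑ (λ t → 𝟙 (i ≡ᵇ t) * 𝟙 (j ≡ᵇ x ∸ t)) (cutShares s x) ≡ 𝟙 (cutAllowed s i ∧ (i + j ≡ᵇ x))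
cutShares-select false x i j 0<j with ℕP.<-cmp i x
... | tri< i<x _ _ = begin
  ∑ (λ t → 𝟙 (i ≡ᵇ t) * 𝟙 (j ≡ᵇ x ∸ t)) (upTo x)
    ≡⟨ ∑-upTo-single _ i<x (λ t t≢i → cong (λ b → 𝟙 b * 𝟙 (j ≡ᵇ x ∸ t)) (≡ᵇ-≢ (t≢i ∘ sym))) ⟩
  𝟙 (i ≡ᵇ i) * 𝟙 (j ≡ᵇ x ∸ i)
    ≡⟨ cong (λ b → 𝟙 b * 𝟙 (j ≡ᵇ x ∸ i)) (≡ᵇ-refl i) ⟩
  1ℤ * 𝟙 (j ≡ᵇ x ∸ i)
    ≡⟨ ℤP.*-identityˡ _ ⟩
  𝟙 (j ≡ᵇ x ∸ i)
    ≡⟨ cong 𝟙 (≡ᵇ-+ˡ i j (x ∸ i)) ⟨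
  𝟙 (i + j ≡ᵇ i + (x ∸ i))
    ≡⟨ cong (λ z → 𝟙 (i + j ≡ᵇ z)) (ℕP.m+[n∸m]≡n (ℕP.<⇒≤ i<x)) ⟩
  𝟙 (i + j ≡ᵇ x) ∎
  where open ≡-Reasoning
... | tri≈ _ i≡x _ =
  trans (∑-vanishing (cutShares-< false x) (λ t t<x → cong (λ b → 𝟙 b * 𝟙 (j ≡ᵇ x ∸ t))
                       (≡ᵇ-≢ (λ i≡t → ℕP.<-irrefl (trans (sym i≡t) i≡x) t<x))))
        (cong 𝟙 (sym (≡ᵇ-≢ (ℕP.>⇒≢ (subst (_< i + j) i≡x (ℕP.m<m+n i 0<j))))))
... | tri> _ _ x<i =
  trans (∑-vanishing (cutShares-< false x) (λ t t<x → cong (λ b → 𝟙 b * 𝟙 (j ≡ᵇ x ∸ t))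
                       (≡ᵇ-≢ (ℕP.>⇒≢ (ℕP.<-trans t<x x<i)))))
        (cong 𝟙 (sym (≡ᵇ-≢ (ℕP.>⇒≢ (ℕP.<-≤-trans x<i (ℕP.m≤m+n i j))))))
cutShares-select true zero    i j 0<j =
  cong 𝟙 (sym (trans (cong ((i ≡ᵇ 0) ∧_) (≡ᵇ-≢ (ℕP.>⇒≢ (ℕP.<-≤-trans 0<j (ℕP.m≤n+m j i))))) (∧-zeroʳ _)))
cutShares-select true (suc x) zero    j 0<j = trans (ℤP.+-identityʳ _) (ℤP.*-identityˡ _)
cutShares-select true (suc x) (suc i) j 0<j = refl

pointMass : ∀ {k} → Vec ℕ k → Vec ℕ k → Vec ℕ k → Vec ℕ k → ℤ
pointMass u₀ v₀ u v = 𝟙 (u₀ ==v u) * 𝟙 (v₀ ==v v)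

splitSum-pointMass : ∀ s {k} (a u₀ v₀ : Vec ℕ k) →
  splitSum s a (pointMass u₀ v₀) ≡ 𝟙 (separated s u₀ v₀) * 𝟙 ((u₀ +v v₀) ==v a)
splitSum-pointMass s []      []       []       = refl
splitSum-pointMass s (x ∷ a) (i ∷ u₀) (zero ∷ v₀) = begin
  splitSum s (x ∷ a) (pointMass (i ∷ u₀) (0 ∷ v₀))
    ≡⟨ splitSum-∷ s x a _ ⟩
  splitSum s a (λ u v → 𝟙 ((i ≡ᵇ x) ∧ (u₀ ==v u)) * 𝟙 (v₀ ==v v)) +ℤ ∑ _ (cutShares s x)
    ≡⟨ cong₂ _+ℤ_ (splitSum-cong s a (λ u v → reassoc (i ≡ᵇ x) (u₀ ==v u) (v₀ ==v v))) cut-terms-vanish ⟩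
  splitSum s a (λ u v → 𝟙 (i ≡ᵇ x) * pointMass u₀ v₀ u v) +ℤ 0ℤ
    ≡⟨ ℤP.+-identityʳ _ ⟩
  splitSum s a (λ u v → 𝟙 (i ≡ᵇ x) * pointMass u₀ v₀ u v)
    ≡⟨ splitSum-*ˡ s a (𝟙 (i ≡ᵇ x)) (pointMass u₀ v₀) ⟩
  𝟙 (i ≡ᵇ x) * splitSum s a (pointMass u₀ v₀)
    ≡⟨ cong (𝟙 (i ≡ᵇ x) *_) (splitSum-pointMass s a u₀ v₀) ⟩
  𝟙 (i ≡ᵇ x) * (𝟙 (separated s u₀ v₀) * 𝟙 ((u₀ +v v₀) ==v a))
    ≡⟨ swap (𝟙 (i ≡ᵇ x)) (𝟙 (separated s u₀ v₀)) _ ⟩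
  𝟙 (separated s u₀ v₀) * (𝟙 (i ≡ᵇ x) * 𝟙 ((u₀ +v v₀) ==v a))
    ≡⟨ cong (𝟙 (separated s u₀ v₀) *_) (𝟙-∧ (i ≡ᵇ x) _) ⟨
  𝟙 (separated s u₀ v₀) * 𝟙 ((i ≡ᵇ x) ∧ ((u₀ +v v₀) ==v a))
    ≡⟨ cong (λ z → 𝟙 (separated s u₀ v₀) * 𝟙 ((z ≡ᵇ x) ∧ ((u₀ +v v₀) ==v a))) (ℕP.+-identityʳ i) ⟨
  𝟙 (separated s (i ∷ u₀) (0 ∷ v₀)) * 𝟙 (((i ∷ u₀) +v (0 ∷ v₀)) ==v (x ∷ a)) ∎
  where
  open ≡-Reasoning
  reassoc : ∀ a b c → 𝟙 (a ∧ b) * 𝟙 c ≡ 𝟙 a * (𝟙 b * 𝟙 c)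
  reassoc a b c = trans (cong (_* 𝟙 c) (𝟙-∧ a b)) (ℤP.*-assoc (𝟙 a) (𝟙 b) (𝟙 c))
  swap : ∀ a b c → a * (b * c) ≡ b * (a * c)
  swap = solve-∀
  cut-terms-vanish : ∑ (λ t → pointMass (i ∷ u₀) (0 ∷ v₀) (t ∷ zeros) ((x ∸ t) ∷ a)) (cutShares s x) ≡ 0ℤ
  cut-terms-vanish = ∑-vanishing (cutShares-< s x) λ t t<x →
    trans (cong (λ b → 𝟙 ((i ≡ᵇ t) ∧ (u₀ ==v zeros)) * 𝟙 (b ∧ (v₀ ==v a))) (≡ᵇ-≢ (ℕP.<⇒≢ (ℕP.m<n⇒0<n∸m t<x))))
          (ℤP.*-zeroʳ (𝟙 ((i ≡ᵇ t) ∧ (u₀ ==v zeros))))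
splitSum-pointMass s (x ∷ a) (i ∷ u₀) (suc j ∷ v₀) = begin
  splitSum s (x ∷ a) (pointMass (i ∷ u₀) (suc j ∷ v₀))
    ≡⟨ splitSum-∷ s x a _ ⟩
  splitSum s a (λ u v → 𝟙 ((i ≡ᵇ x) ∧ (u₀ ==v u)) * 𝟙 false) +ℤ ∑ _ (cutShares s x)
    ≡⟨ cong₂ _+ℤ_ (splitSum-zero s a (λ u v → ℤP.*-zeroʳ (𝟙 ((i ≡ᵇ x) ∧ (u₀ ==v u)))))
                  (∑-cong (cutShares s x) (λ t → reorder (i ≡ᵇ t) (u₀ ==v zeros) (suc j ≡ᵇ x ∸ t) (v₀ ==v a))) ⟩
  0ℤ +ℤ ∑ (λ t → (𝟙 (u₀ ==v zeros) * 𝟙 (v₀ ==v a)) * (𝟙 (i ≡ᵇ t) * 𝟙 (suc j ≡ᵇ x ∸ t))) (cutShares s x)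
    ≡⟨ ℤP.+-identityˡ _ ⟩
  ∑ (λ t → (𝟙 (u₀ ==v zeros) * 𝟙 (v₀ ==v a)) * (𝟙 (i ≡ᵇ t) * 𝟙 (suc j ≡ᵇ x ∸ t))) (cutShares s x)
    ≡⟨ ∑-*ˡ (𝟙 (u₀ ==v zeros) * 𝟙 (v₀ ==v a)) (λ t → 𝟙 (i ≡ᵇ t) * 𝟙 (suc j ≡ᵇ x ∸ t)) (cutShares s x) ⟩
  (𝟙 (u₀ ==v zeros) * 𝟙 (v₀ ==v a)) * ∑ (λ t → 𝟙 (i ≡ᵇ t) * 𝟙 (suc j ≡ᵇ x ∸ t)) (cutShares s x)
    ≡⟨ cong ((𝟙 (u₀ ==v zeros) * 𝟙 (v₀ ==v a)) *_) (cutShares-select s x i (suc j) z<s) ⟩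
  (𝟙 (u₀ ==v zeros) * 𝟙 (v₀ ==v a)) * 𝟙 (cutAllowed s i ∧ (i + suc j ≡ᵇ x))
    ≡⟨ u₀-vanishes u₀ (u₀ ==v zeros) refl ⟩
  𝟙 (separated s (i ∷ u₀) (suc j ∷ v₀)) * 𝟙 (((i ∷ u₀) +v (suc j ∷ v₀)) ==v (x ∷ a)) ∎
  where
  open ≡-Reasoning
  reorder : ∀ a b c d → 𝟙 (a ∧ b) * 𝟙 (c ∧ d) ≡ (𝟙 b * 𝟙 d) * (𝟙 a * 𝟙 c)
  reorder a b c d = trans (cong₂ _*_ (𝟙-∧ a b) (𝟙-∧ c d)) (rearrange (𝟙 a) (𝟙 b) (𝟙 c) (𝟙 d))
    where
    rearrange : ∀ a b c d → (a * b) * (c * d) ≡ (b * d) * (a * c)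
    rearrange = solve-∀
  u₀-vanishes : ∀ u₀ z → (u₀ ==v zeros) ≡ z →
    (𝟙 z * 𝟙 (v₀ ==v a)) * 𝟙 (cutAllowed s i ∧ (i + suc j ≡ᵇ x))
    ≡ 𝟙 ((cutAllowed s i ∧ z) ∧ separated s u₀ v₀) * 𝟙 ((i + suc j ≡ᵇ x) ∧ ((u₀ +v v₀) ==v a))
  u₀-vanishes u₀ false _ rewrite ∧-zeroʳ (cutAllowed s i) = refl
  u₀-vanishes u₀ true u₀==0 rewrite ==v⇒≡ u₀ zeros u₀==0 | separated-zeros s v₀ | zeros-+v v₀
                                  | ∧-identityʳ (cutAllowed s i) | ∧-identityʳ (cutAllowed s i) = begin
    (1ℤ * 𝟙 (v₀ ==v a)) * 𝟙 (cutAllowed s i ∧ e)  ≡⟨ cong₂ _*_ (ℤP.*-identityˡ (𝟙 (v₀ ==v a))) (𝟙-∧ (cutAllowed s i) e) ⟩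
    𝟙 (v₀ ==v a) * (𝟙 (cutAllowed s i) * 𝟙 e)     ≡⟨ rotate (𝟙 (v₀ ==v a)) (𝟙 (cutAllowed s i)) (𝟙 e) ⟩
    𝟙 (cutAllowed s i) * (𝟙 e * 𝟙 (v₀ ==v a))     ≡⟨ cong (𝟙 (cutAllowed s i) *_) (𝟙-∧ e (v₀ ==v a)) ⟨
    𝟙 (cutAllowed s i) * 𝟙 (e ∧ (v₀ ==v a))       ∎
    where
    e = i + suc j ≡ᵇ x
    rotate : ∀ a b c → a * (b * c) ≡ b * (c * a)
    rotate = solve-∀

-- Products of fundamental quasisymmetric functions

fcoeff⊗ : List ℕ → List ℕ → ∀ {k} → Vec ℕ k → Vec ℕ k → ℤ
fcoeff⊗ α β u v = fcoeff α (nonzeros u) * fcoeff β (nonzeros v)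

nonzeros-zeros : ∀ k → nonzeros (zeros {k}) ≡ []
nonzeros-zeros zero    = refl
nonzeros-zeros (suc k) = nonzeros-zeros k

splitSum-[] : ∀ s (h : Vec ℕ 0 → Vec ℕ 0 → ℤ) → splitSum s [] h ≡ h [] []
splitSum-[] s h = ℤP.+-identityʳ (h [] [])

fcoeff-single-≢ : ∀ {k} p α t → t ≢ p → fcoeff (p ∷ α) (nonzeros (t ∷ zeros {k})) ≡ 0ℤ
fcoeff-single-≢ {k} p α zero    _   rewrite nonzeros-zeros k = refl
fcoeff-single-≢ {k} p α (suc t) t≢p rewrite nonzeros-zeros k with ℕP.<-cmp (suc t) p
... | tri< t<p _ _ rewrite fcoeff-< α [] t<p = refl
... | tri≈ _ t≡p _ = ⊥-elim (t≢p t≡p)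
... | tri> _ _ p<t = fcoeff-> α [] p<t

fcoeff-single-≡ : ∀ {k} p α → 0 < p → fcoeff (p ∷ α) (nonzeros (p ∷ zeros {k})) ≡ fcoeff α []
fcoeff-single-≡ {k} (suc p) α _ rewrite nonzeros-zeros k = fcoeff-≡ (suc p) α []

fcoeff-↑c-[] : ∀ α β → Positive β → fcoeff α [] * fcoeff β [] ≡ fcoeff (α ↑c β) []
fcoeff-↑c-[] []          β       _ = ℤP.*-identityˡ _
fcoeff-↑c-[] (p ∷ q ∷ α) β       _ = ℤP.*-zeroˡ (fcoeff β [])
fcoeff-↑c-[] (p ∷ [])    []      _ = refl
fcoeff-↑c-[] (p ∷ [])    (q ∷ β) _ = ℤP.*-zeroˡ (fcoeff (q ∷ β) [])

fcoeff-↑c-< : ∀ {x p} α β δ → Positive β → x < p → fcoeff ((p ∷ α) ↑c β) (x ∷ δ) ≡ fcoeff (((p ∸ x) ∷ α) ↑c β) δ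
fcoeff-↑c-< (_ ∷ α) β       δ _ x<p = fcoeff-< _ δ x<p
fcoeff-↑c-< []      []      δ _ x<p = fcoeff-< [] δ x<p
fcoeff-↑c-< {p = p} [] (q ∷ β) δ _ x<p =
  trans (fcoeff-< β δ (ℕP.<-≤-trans x<p (ℕP.m≤m+n p q))) (cong (λ z → fcoeff (z ∷ β) δ) (ℕP.+-∸-comm q (ℕP.<⇒≤ x<p)))

fcoeff-↑c-≡ : ∀ p α β δ → Positive β → fcoeff ((p ∷ α) ↑c β) (p ∷ δ) ≡ fcoeff (α ↑c β) δ
fcoeff-↑c-≡ p (_ ∷ α) β           δ _ = fcoeff-≡ p _ δ
fcoeff-↑c-≡ p []      []          δ _ = fcoeff-≡ p [] δ
fcoeff-↑c-≡ p []      (suc q ∷ β) δ _ =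
  trans (fcoeff-< β δ (ℕP.m<m+n p z<s)) (cong (λ z → fcoeff (z ∷ β) δ) (ℕP.m+n∸m≡n p (suc q)))

fcoeff-↑c-> : ∀ {x p} α β δ → p < x → fcoeff ((p ∷ α) ↑c β) (x ∷ δ) ≡ fcoeff α [] * fcoeff β ((x ∸ p) ∷ δ)
fcoeff-↑c-> {x} {p} (q ∷ α) β δ p<x = trans (fcoeff-> _ δ p<x) (sym (ℤP.*-zeroˡ (fcoeff β ((x ∸ p) ∷ δ))))
fcoeff-↑c-> []      []      δ p<x = fcoeff-> [] δ p<x
fcoeff-↑c-> {x} {p} [] (q ∷ β) δ p<x = begin
  fcoeff ((p + q) ∷ β) (x ∷ δ)             ≡⟨ cong (λ z → fcoeff ((p + q) ∷ β) (z ∷ δ)) (ℕP.m+[n∸m]≡n (ℕP.<⇒≤ p<x)) ⟨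
  fcoeff ((p + q) ∷ β) ((p + (x ∸ p)) ∷ δ) ≡⟨ fcoeff-+ p q (x ∸ p) β δ ⟩
  fcoeff (q ∷ β) ((x ∸ p) ∷ δ)             ≡⟨ ℤP.*-identityˡ _ ⟨
  1ℤ * fcoeff (q ∷ β) ((x ∸ p) ∷ δ)        ∎
  where open ≡-Reasoning

splitSum-0∷ : ∀ s {k} (a : Vec ℕ k) h → splitSum s (0 ∷ a) h ≡ splitSum s a (λ u v → h (0 ∷ u) (0 ∷ v))
splitSum-0∷ false a h = trans (splitSum-∷ false 0 a h) (ℤP.+-identityʳ _)
splitSum-0∷ true  a h = trans (splitSum-∷ true 0 a h) (ℤP.+-identityʳ _)

nonzeros-∷ : ∀ {k y} (a : Vec ℕ k) → 0 < y → nonzeros (y ∷ a) ≡ y ∷ nonzeros a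
nonzeros-∷ {y = suc y} a _ = refl

module _ (s : Bool) (β : List ℕ) {k} (a : Vec ℕ k) where

  splitSum-fcoeff⊗-head : ∀ α α' x → (∀ δ → fcoeff α (suc x ∷ δ) ≡ fcoeff α' δ) →
    splitSum s a (λ u v → fcoeff⊗ α β (suc x ∷ u) (0 ∷ v)) ≡ splitSum s a (fcoeff⊗ α' β)
  splitSum-fcoeff⊗-head α α' x eq = splitSum-cong s a (λ u v → cong (_* fcoeff β (nonzeros v)) (eq (nonzeros u)))

  splitSum-fcoeff⊗-head-> : ∀ α x → (∀ δ → fcoeff α (suc x ∷ δ) ≡ 0ℤ) →
    splitSum s a (λ u v → fcoeff⊗ α β (suc x ∷ u) (0 ∷ v)) ≡ 0ℤ
  splitSum-fcoeff⊗-head-> α x eq =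
    splitSum-zero s a (λ u v → trans (cong (_* fcoeff β (nonzeros v)) (eq (nonzeros u))) (ℤP.*-zeroˡ (fcoeff β (nonzeros v))))

  cut-fcoeff⊗-vanishes : ∀ p α x → All (_≢ p) (cutShares s x) →
    ∑ (λ t → fcoeff⊗ (p ∷ α) β (t ∷ zeros) ((x ∸ t) ∷ a)) (cutShares s x) ≡ 0ℤ
  cut-fcoeff⊗-vanishes p α x t≢p = ∑-vanishing t≢p (λ t t≢p →
    trans (cong (_* fcoeff β (nonzeros ((x ∸ t) ∷ a))) (fcoeff-single-≢ p α t t≢p)) (ℤP.*-zeroˡ (fcoeff β (nonzeros ((x ∸ t) ∷ a)))))

splitSum-fcoeff⊗-↑ : ∀ α β → Positive α → Positive β → ∀ {k} (a : Vec ℕ k) →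
  splitSum false a (fcoeff⊗ α β) ≡ fcoeff (α ↑c β) (nonzeros a)
splitSum-fcoeff⊗-↑ α β pα pβ [] = trans (splitSum-[] false (fcoeff⊗ α β)) (fcoeff-↑c-[] α β pβ)
splitSum-fcoeff⊗-↑ α β pα pβ (zero ∷ a) = trans (splitSum-0∷ false a (fcoeff⊗ α β)) (splitSum-fcoeff⊗-↑ α β pα pβ a)
splitSum-fcoeff⊗-↑ [] β pα pβ {suc k} (suc x ∷ a) = begin
  splitSum false (suc x ∷ a) (fcoeff⊗ [] β)
    ≡⟨ splitSum-∷ false (suc x) a (fcoeff⊗ [] β) ⟩
  splitSum false a (λ u v → fcoeff⊗ [] β (suc x ∷ u) (0 ∷ v)) +ℤ ∑ cut (upTo (suc x))
    ≡⟨ cong₂ _+ℤ_ (splitSum-fcoeff⊗-head-> false β a [] x (λ _ → refl))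
                  (∑-upTo-single cut {x = suc x} z<s λ { zero 0≢0 → ⊥-elim (0≢0 refl)
                                                        ; (suc t) _ → ℤP.*-zeroˡ (fcoeff β (nonzeros ((x ∸ t) ∷ a))) }) ⟩
  0ℤ +ℤ fcoeff [] (nonzeros (zeros {k})) * fcoeff β (suc x ∷ nonzeros a)
    ≡⟨ ℤP.+-identityˡ _ ⟩
  fcoeff [] (nonzeros (zeros {k})) * fcoeff β (suc x ∷ nonzeros a)
    ≡⟨ cong (λ δ → fcoeff [] δ * fcoeff β (suc x ∷ nonzeros a)) (nonzeros-zeros k) ⟩
  1ℤ * fcoeff β (suc x ∷ nonzeros a)
    ≡⟨ ℤP.*-identityˡ _ ⟩
  fcoeff β (suc x ∷ nonzeros a) ∎
  where
  open ≡-Reasoning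
  cut = λ t → fcoeff⊗ [] β (t ∷ zeros) ((suc x ∸ t) ∷ a)
splitSum-fcoeff⊗-↑ (p ∷ α) β pα pβ {suc k} (suc x ∷ a) with ℕP.<-cmp (suc x) p
... | tri< x<p _ _ = begin
  splitSum false (suc x ∷ a) (fcoeff⊗ (p ∷ α) β)
    ≡⟨ splitSum-∷ false (suc x) a (fcoeff⊗ (p ∷ α) β) ⟩
  splitSum false a (λ u v → fcoeff⊗ (p ∷ α) β (suc x ∷ u) (0 ∷ v)) +ℤ ∑ cut (upTo (suc x))
    ≡⟨ cong₂ _+ℤ_ (splitSum-fcoeff⊗-head false β a (p ∷ α) ((p ∸ suc x) ∷ α) x (λ δ → fcoeff-< α δ x<p))
                  (cut-fcoeff⊗-vanishes false β a p α (suc x) (All.applyUpTo⁺₁ _ (suc x) (λ t<x → ℕP.<⇒≢ (ℕP.<-trans t<x x<p)))) ⟩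
  splitSum false a (fcoeff⊗ ((p ∸ suc x) ∷ α) β) +ℤ 0ℤ
    ≡⟨ ℤP.+-identityʳ _ ⟩
  splitSum false a (fcoeff⊗ ((p ∸ suc x) ∷ α) β)
    ≡⟨ splitSum-fcoeff⊗-↑ ((p ∸ suc x) ∷ α) β (positive-∸∷ α x<p (positive-tail p α pα)) pβ a ⟩
  fcoeff (((p ∸ suc x) ∷ α) ↑c β) (nonzeros a)
    ≡⟨ fcoeff-↑c-< α β (nonzeros a) pβ x<p ⟨
  fcoeff ((p ∷ α) ↑c β) (suc x ∷ nonzeros a) ∎
  where
  open ≡-Reasoning
  cut = λ t → fcoeff⊗ (p ∷ α) β (t ∷ zeros) ((suc x ∸ t) ∷ a)
... | tri≈ _ refl _ = begin
  splitSum false (p ∷ a) (fcoeff⊗ (p ∷ α) β)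
    ≡⟨ splitSum-∷ false p a (fcoeff⊗ (p ∷ α) β) ⟩
  splitSum false a (λ u v → fcoeff⊗ (p ∷ α) β (p ∷ u) (0 ∷ v)) +ℤ ∑ cut (upTo p)
    ≡⟨ cong₂ _+ℤ_ (splitSum-fcoeff⊗-head false β a (p ∷ α) α x (fcoeff-≡ p α))
                  (cut-fcoeff⊗-vanishes false β a p α p (All.applyUpTo⁺₁ _ p ℕP.<⇒≢)) ⟩
  splitSum false a (fcoeff⊗ α β) +ℤ 0ℤ
    ≡⟨ ℤP.+-identityʳ _ ⟩
  splitSum false a (fcoeff⊗ α β)
    ≡⟨ splitSum-fcoeff⊗-↑ α β (positive-tail p α pα) pβ a ⟩
  fcoeff (α ↑c β) (nonzeros a)
    ≡⟨ fcoeff-↑c-≡ p α β (nonzeros a) pβ ⟨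
  fcoeff ((p ∷ α) ↑c β) (p ∷ nonzeros a) ∎
  where
  open ≡-Reasoning
  cut = λ t → fcoeff⊗ (p ∷ α) β (t ∷ zeros) ((p ∸ t) ∷ a)
... | tri> _ _ p<x = begin
  splitSum false (suc x ∷ a) (fcoeff⊗ (p ∷ α) β)
    ≡⟨ splitSum-∷ false (suc x) a (fcoeff⊗ (p ∷ α) β) ⟩
  splitSum false a (λ u v → fcoeff⊗ (p ∷ α) β (suc x ∷ u) (0 ∷ v)) +ℤ ∑ cut (upTo (suc x))
    ≡⟨ cong₂ _+ℤ_ (splitSum-fcoeff⊗-head-> false β a (p ∷ α) x (λ δ → fcoeff-> α δ p<x))
                  (∑-upTo-single cut p<x (λ t t≢p → trans (cong (_* _) (fcoeff-single-≢ p α t t≢p))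
                                                         (ℤP.*-zeroˡ (fcoeff β (nonzeros ((suc x ∸ t) ∷ a)))))) ⟩
  0ℤ +ℤ cut p
    ≡⟨ ℤP.+-identityˡ (cut p) ⟩
  fcoeff (p ∷ α) (nonzeros (p ∷ zeros {k})) * fcoeff β (nonzeros ((suc x ∸ p) ∷ a))
    ≡⟨ cong₂ _*_ (fcoeff-single-≡ p α (positive-head p α pα)) (cong (fcoeff β) (nonzeros-∷ a (ℕP.m<n⇒0<n∸m p<x))) ⟩
  fcoeff α [] * fcoeff β ((suc x ∸ p) ∷ nonzeros a)
    ≡⟨ fcoeff-↑c-> α β (nonzeros a) p<x ⟨
  fcoeff ((p ∷ α) ↑c β) (suc x ∷ nonzeros a) ∎
  where
  open ≡-Reasoning
  cut = λ t → fcoeff⊗ (p ∷ α) β (t ∷ zeros) ((suc x ∸ t) ∷ a)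

fcoeff-++-[] : ∀ α β → fcoeff α [] * fcoeff β [] ≡ fcoeff (α ++ β) []
fcoeff-++-[] []      β = ℤP.*-identityˡ _
fcoeff-++-[] (p ∷ α) β = ℤP.*-zeroˡ (fcoeff β [])

splitSum-fcoeff⊗-⇑ : ∀ α β → Positive α → Positive β → ∀ {k} (a : Vec ℕ k) →
  splitSum true a (fcoeff⊗ α β) ≡ fcoeff (α ++ β) (nonzeros a)
splitSum-fcoeff⊗-⇑ α β pα pβ [] = trans (splitSum-[] true (fcoeff⊗ α β)) (fcoeff-++-[] α β)
splitSum-fcoeff⊗-⇑ α β pα pβ (zero ∷ a) = trans (splitSum-0∷ true a (fcoeff⊗ α β)) (splitSum-fcoeff⊗-⇑ α β pα pβ a)
splitSum-fcoeff⊗-⇑ [] β pα pβ {suc k} (suc x ∷ a) = begin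
  splitSum true (suc x ∷ a) (fcoeff⊗ [] β)
    ≡⟨ splitSum-∷ true (suc x) a (fcoeff⊗ [] β) ⟩
  splitSum true a (λ u v → fcoeff⊗ [] β (suc x ∷ u) (0 ∷ v)) +ℤ (cut +ℤ 0ℤ)
    ≡⟨ cong₂ _+ℤ_ (splitSum-fcoeff⊗-head-> true β a [] x (λ _ → refl)) (ℤP.+-identityʳ cut) ⟩
  0ℤ +ℤ cut
    ≡⟨ ℤP.+-identityˡ cut ⟩
  fcoeff [] (nonzeros (zeros {suc k})) * fcoeff β (suc x ∷ nonzeros a)
    ≡⟨ cong (λ δ → fcoeff [] δ * fcoeff β (suc x ∷ nonzeros a)) (nonzeros-zeros (suc k)) ⟩
  1ℤ * fcoeff β (suc x ∷ nonzeros a)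
    ≡⟨ ℤP.*-identityˡ _ ⟩
  fcoeff β (suc x ∷ nonzeros a) ∎
  where
  open ≡-Reasoning
  cut = fcoeff⊗ [] β (0 ∷ zeros) (suc x ∷ a)
splitSum-fcoeff⊗-⇑ (p ∷ α) β pα pβ (suc x ∷ a) = begin
  splitSum true (suc x ∷ a) (fcoeff⊗ (p ∷ α) β)
    ≡⟨ splitSum-∷ true (suc x) a (fcoeff⊗ (p ∷ α) β) ⟩
  head +ℤ ∑ (λ t → fcoeff⊗ (p ∷ α) β (t ∷ zeros) ((suc x ∸ t) ∷ a)) (0 ∷ [])
    ≡⟨ cong (head +ℤ_) (cut-fcoeff⊗-vanishes true β a p α (suc x) (ℕP.<⇒≢ (positive-head p α pα) ∷ [])) ⟩
  head +ℤ 0ℤ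
    ≡⟨ ℤP.+-identityʳ head ⟩
  head
    ≡⟨ head≡ ⟩
  fcoeff (p ∷ (α ++ β)) (suc x ∷ nonzeros a) ∎
  where
  open ≡-Reasoning
  head = splitSum true a (λ u v → fcoeff⊗ (p ∷ α) β (suc x ∷ u) (0 ∷ v))
  head≡ : head ≡ fcoeff (p ∷ (α ++ β)) (suc x ∷ nonzeros a)
  head≡ with ℕP.<-cmp (suc x) p
  ... | tri< x<p _ _ = begin
    head
      ≡⟨ splitSum-fcoeff⊗-head true β a (p ∷ α) ((p ∸ suc x) ∷ α) x (λ δ → fcoeff-< α δ x<p) ⟩
    splitSum true a (fcoeff⊗ ((p ∸ suc x) ∷ α) β)
      ≡⟨ splitSum-fcoeff⊗-⇑ ((p ∸ suc x) ∷ α) β (positive-∸∷ α x<p (positive-tail p α pα)) pβ a ⟩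
    fcoeff ((p ∸ suc x) ∷ (α ++ β)) (nonzeros a)
      ≡⟨ fcoeff-< (α ++ β) (nonzeros a) x<p ⟨
    fcoeff (p ∷ (α ++ β)) (suc x ∷ nonzeros a) ∎
  ... | tri≈ _ refl _ = begin
    head                                          ≡⟨ splitSum-fcoeff⊗-head true β a (p ∷ α) α x (fcoeff-≡ p α) ⟩
    splitSum true a (fcoeff⊗ α β)                 ≡⟨ splitSum-fcoeff⊗-⇑ α β (positive-tail p α pα) pβ a ⟩
    fcoeff (α ++ β) (nonzeros a)                  ≡⟨ fcoeff-≡ p (α ++ β) (nonzeros a) ⟨
    fcoeff (p ∷ (α ++ β)) (p ∷ nonzeros a)        ∎
  ... | tri> _ _ p<x = trans (splitSum-fcoeff⊗-head-> true β a (p ∷ α) x (λ δ → fcoeff-> α δ p<x))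
                             (sym (fcoeff-> (α ++ β) (nonzeros a) p<x))

module _ (s : Bool) (_⋆_ : List ℕ → List ℕ → List ℕ)
         (positive-⋆ : ∀ α β → Positive α → Positive β → Positive (α ⋆ β))
         (splitSum-fcoeff⊗ : ∀ α β → Positive α → Positive β → ∀ {k} (a : Vec ℕ k) →
                             splitSum s a (fcoeff⊗ α β) ≡ fcoeff (α ⋆ β) (nonzeros a))
         where

  splitSum-combo : ∀ m n c d k (a : Vec ℕ k) →
    splitSum s a (λ u v → combo m c k u * combo n d k v) ≡ prodCombo _⋆_ m n c d k a
  splitSum-combo m n c d k a = begin
    splitSum s a (λ u v → combo m c k u * combo n d k v)
      ≡⟨ splitSum-cong s a (λ u v → expand u v) ⟩
    splitSum s a (λ u v → ∑ (λ α → ∑ (λ β → (c α * d β) * fcoeff⊗ α β u v) (comps n)) (comps m))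
      ≡⟨ splitSum-∑ s a _ (comps m) ⟩
    ∑ (λ α → splitSum s a (λ u v → ∑ (λ β → (c α * d β) * fcoeff⊗ α β u v) (comps n))) (comps m)
      ≡⟨ ∑-congᴬ (comps-positive m) (λ α pα → trans (splitSum-∑ s a _ (comps n))
           (∑-congᴬ (comps-positive n) (λ β pβ → term α β pα pβ))) ⟩
    prodCombo _⋆_ m n c d k a ∎
    where
    open ≡-Reasoning
    expand : ∀ u v → combo m c k u * combo n d k v ≡ ∑ (λ α → ∑ (λ β → (c α * d β) * fcoeff⊗ α β u v) (comps n)) (comps m)
    expand u v =
      trans (∑-*-∑ (λ α → c α * F α k u) (λ β → d β * F β k v) (comps m) (comps n))
            (∑-congᴬ (comps-positive m) (λ α pα → ∑-congᴬ (comps-positive n) (λ β pβ →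
              trans (interchange (c α) (F α k u) (d β) (F β k v))
                    (cong₂ (λ x y → (c α * d β) * (x * y)) (F≡fcoeff α pα k u) (F≡fcoeff β pβ k v)))))
      where
      interchange : ∀ a b c d → (a * b) * (c * d) ≡ (a * c) * (b * d)
      interchange = solve-∀
    term : ∀ α β → Positive α → Positive β →
           splitSum s a (λ u v → (c α * d β) * fcoeff⊗ α β u v) ≡ (c α * d β) * F (α ⋆ β) k a
    term α β pα pβ = begin
      splitSum s a (λ u v → (c α * d β) * fcoeff⊗ α β u v) ≡⟨ splitSum-*ˡ s a (c α * d β) (fcoeff⊗ α β) ⟩
      (c α * d β) * splitSum s a (fcoeff⊗ α β)             ≡⟨ cong ((c α * d β) *_) (splitSum-fcoeff⊗ α β pα pβ a) ⟩
      (c α * d β) * fcoeff (α ⋆ β) (nonzeros a)            ≡⟨ cong ((c α * d β) *_) (F≡fcoeff (α ⋆ β) (positive-⋆ α β pα pβ) k a) ⟨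
      (c α * d β) * F (α ⋆ β) k a                          ∎

-- Contents of labellings

every : ∀ {m} → (Fin m → Bool) → Bool
every {zero}  p = true
every {suc m} p = p zero ∧ every (p ∘ suc)

count : ∀ {m} → (Fin m → Bool) → ℕ
count {zero}  p = 0
count {suc m} p = (if p zero then 1 else 0) + count (p ∘ suc)

every-cong : ∀ {m} {p q : Fin m → Bool} → (∀ x → p x ≡ q x) → every p ≡ every q
every-cong {zero}  p≗q = refl
every-cong {suc m} p≗q = cong₂ _∧_ (p≗q zero) (every-cong (p≗q ∘ suc))

count-cong : ∀ {m} {p q : Fin m → Bool} → (∀ x → p x ≡ q x) → count p ≡ count q
count-cong {zero}  p≗q = refl
count-cong {suc m} p≗q rewrite p≗q zero = cong (_ +_) (count-cong (p≗q ∘ suc))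

every⇒ : ∀ {m} (p : Fin m → Bool) → T (every p) → ∀ x → T (p x)
every⇒ p t zero    = proj₁ (Equivalence.to T-∧ t)
every⇒ p t (suc x) = every⇒ (p ∘ suc) (proj₂ (Equivalence.to T-∧ t)) x

⇒every : ∀ {m} (p : Fin m → Bool) → (∀ x → T (p x)) → T (every p)
⇒every {zero}  p h = _
⇒every {suc m} p h = Equivalence.from T-∧ (h zero , ⇒every (p ∘ suc) (h ∘ suc))

every-true : ∀ m → every {m} (λ _ → true) ≡ true
every-true zero    = refl
every-true (suc m) = every-true m

every-∧ : ∀ {m} (p q : Fin m → Bool) → every (λ x → p x ∧ q x) ≡ every p ∧ every q
every-∧ {zero}  p q = refl
every-∧ {suc m} p q = trans (cong ((p zero ∧ q zero) ∧_) (every-∧ (p ∘ suc) (q ∘ suc)))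
                            (∧-interchange (p zero) (q zero) _ _)
  where
  ∧-interchange : ∀ a b c d → (a ∧ b) ∧ (c ∧ d) ≡ (a ∧ c) ∧ (b ∧ d)
  ∧-interchange true  true  c d = refl
  ∧-interchange true  false c d = sym (∧-zeroʳ c)
  ∧-interchange false b c d = refl

every-++ : ∀ m n (p : Fin (m + n) → Bool) → every p ≡ every (λ a → p (a ↑ˡ n)) ∧ every (λ b → p (m ↑ʳ b))
every-++ zero    n p = refl
every-++ (suc m) n p = trans (cong (p zero ∧_) (every-++ m n (p ∘ suc))) (sym (∧-assoc (p zero) _ _))

count-++ : ∀ m n (p : Fin (m + n) → Bool) → count p ≡ count (λ a → p (a ↑ˡ n)) + count (λ b → p (m ↑ʳ b))
count-++ zero    n p = refl
count-++ (suc m) n p =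
  trans (cong ((if p zero then 1 else 0) +_) (count-++ m n (p ∘ suc))) (sym (ℕP.+-assoc (if p zero then 1 else 0) _ _))

count≡0 : ∀ {m} (p : Fin m → Bool) → (∀ x → p x ≡ false) → count p ≡ 0
count≡0 {zero}  p _  = refl
count≡0 {suc m} p p≡f rewrite p≡f zero = count≡0 (p ∘ suc) (p≡f ∘ suc)

count≢0 : ∀ {m} (p : Fin m → Bool) x → p x ≡ true → count p ≢ 0
count≢0 p zero    px rewrite px = λ ()
count≢0 p (suc x) px with p zero
... | true  = λ ()
... | false = count≢0 (p ∘ suc) x px

count≢0⇒witness : ∀ {m} (p : Fin m → Bool) → count p ≢ 0 → ∃ λ x → p x ≡ true
count≢0⇒witness {zero}  p c≢0 = ⊥-elim (c≢0 refl)
count≢0⇒witness {suc m} p c≢0 with p zero in p0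
... | true  = zero , p0
... | false with count≢0⇒witness (p ∘ suc) c≢0
...   | x , px = suc x , px

all-tabulate : ∀ {A : Set} {m} (p : A → Bool) (h : Fin m → A) → all p (List.tabulate h) ≡ every (p ∘ h)
all-tabulate {m = zero}  p h = refl
all-tabulate {m = suc m} p h = cong (p (h zero) ∧_) (all-tabulate p (h ∘ suc))

allᶠ≡every : ∀ {m} (p : Fin m → Bool) → allᶠ p ≡ every p
allᶠ≡every p = all-tabulate p (λ x → x)

length-filter-tabulate : ∀ {A : Set} {P : A → Set} (P? : Decidable P) {m} (h : Fin m → A) →
  length (filter P? (List.tabulate h)) ≡ count (λ x → does (P? (h x)))
length-filter-tabulate P? {zero}  h = refl
length-filter-tabulate P? {suc m} h with does (P? (h zero))
... | true  = cong suc (length-filter-tabulate P? (h ∘ suc))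
... | false = length-filter-tabulate P? (h ∘ suc)

content : ∀ {n k} → (Fin n → Fin k) → Vec ℕ k
content f = Vec.tabulate (λ i → count (λ x → does (f x ≟ᶠ i)))

every-==v : ∀ {k} (C : Fin k → ℕ) (u : Vec ℕ k) → every (λ i → C i ≡ᵇ Vec.lookup u i) ≡ (Vec.tabulate C ==v u)
every-==v C []      = refl
every-==v C (x ∷ u) = cong ((C zero ≡ᵇ x) ∧_) (every-==v (C ∘ suc) u)

hasContent≡content-==v : ∀ {n k} (f : Fin n → Fin k) (u : Vec ℕ k) → hasContent f u ≡ (content f ==v u)
hasContent≡content-==v {n} f u =
  trans (allᶠ≡every (λ i → length (filter (λ x → f x ≟ᶠ i) (List.allFin n)) ≡ᵇ Vec.lookup u i))
        (trans (every-cong (λ i → cong (_≡ᵇ Vec.lookup u i) (length-filter-tabulate (λ x → f x ≟ᶠ i) (λ x → x))))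
               (every-==v _ u))

gap : Bool → ℕ
gap false = 0
gap true  = 1

_≤ᵇ[_]_ : ℕ → Bool → ℕ → Bool
a ≤ᵇ[ false ] b = a ≤ᵇ b
a ≤ᵇ[ true  ] b = a <ᵇ b

≤ᵇ[]⇒ : ∀ s a b → T (a ≤ᵇ[ s ] b) → a + gap s ≤ b
≤ᵇ[]⇒ false a b t = subst (_≤ b) (sym (ℕP.+-identityʳ a)) (ℕP.≤ᵇ⇒≤ a b t)
≤ᵇ[]⇒ true  a b t = subst (_≤ b) (ℕP.+-comm 1 a) (ℕP.<ᵇ⇒< a b t)

⇒≤ᵇ[] : ∀ s a b → a + gap s ≤ b → T (a ≤ᵇ[ s ] b)
⇒≤ᵇ[] false a b a≤b = ℕP.≤⇒≤ᵇ (subst (_≤ b) (ℕP.+-identityʳ a) a≤b)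
⇒≤ᵇ[] true  a b a<b = ℕP.<⇒<ᵇ (subst (_≤ b) (ℕP.+-comm a 1) a<b)

-- With F and G the contents of f and g, this says that no value of f exceeds (or, if s, reaches) a value of g.
Separable : Bool → ∀ {k} → (Fin k → ℕ) → (Fin k → ℕ) → Set
Separable s F G = ∀ p q → toℕ p < toℕ q + gap s → G p ≡ 0 ⊎ F q ≡ 0

==v-zeros⇒ : ∀ {k} (F : Fin k → ℕ) → T (Vec.tabulate F ==v zeros) → ∀ q → F q ≡ 0
==v-zeros⇒ F t zero    = ℕP.≡ᵇ⇒≡ _ 0 (proj₁ (Equivalence.to T-∧ t))
==v-zeros⇒ F t (suc q) = ==v-zeros⇒ (F ∘ suc) (proj₂ (Equivalence.to T-∧ t)) q

⇒==v-zeros : ∀ {k} (F : Fin k → ℕ) → (∀ q → F q ≡ 0) → T (Vec.tabulate F ==v zeros)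
⇒==v-zeros {zero}  F _   = _
⇒==v-zeros {suc k} F F≡0 = Equivalence.from T-∧ (ℕP.≡⇒≡ᵇ _ 0 (F≡0 zero) , ⇒==v-zeros (F ∘ suc) (F≡0 ∘ suc))

separated⇒Separable : ∀ s {k} (F G : Fin k → ℕ) → T (separated s (Vec.tabulate F) (Vec.tabulate G)) → Separable s F G
separated⇒Separable s F G t zero q q≥0 with G zero ≡ᵇ 0 in G0
... | true  = inj₁ (ℕP.≡ᵇ⇒≡ _ 0 (subst T (sym G0) _))
... | false = inj₂ (F-vanishes s q q≥0 (proj₁ (Equivalence.to T-∧ t)))
  where
  F-vanishes : ∀ s q → 0 < toℕ q + gap s → T (cutAllowed s (F zero) ∧ (Vec.tabulate (F ∘ suc) ==v zeros)) → F q ≡ 0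
  F-vanishes true  zero    _       t = ℕP.≡ᵇ⇒≡ _ 0 (proj₁ (Equivalence.to T-∧ t))
  F-vanishes s     (suc q) _       t = ==v-zeros⇒ (F ∘ suc) (proj₂ (Equivalence.to (T-∧ {cutAllowed s (F zero)}) t)) q
separated⇒Separable false F G t (suc p) zero    ()
separated⇒Separable true  F G t (suc p) zero    (s<s ())
separated⇒Separable s     F G t (suc p) (suc q) (s<s p<q) =
  separated⇒Separable s (F ∘ suc) (G ∘ suc) (proj₂ (Equivalence.to T-∧ t)) p q p<q

Separable⇒separated : ∀ s {k} (F G : Fin k → ℕ) → Separable s F G → T (separated s (Vec.tabulate F) (Vec.tabulate G))
Separable⇒separated s {zero}  F G _   = _
Separable⇒separated s {suc k} F G sep =
  Equivalence.from T-∧ (head , Separable⇒separated s (F ∘ suc) (G ∘ suc) (λ p q p<q → sep (suc p) (suc q) (s<s p<q)))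
  where
  F-later : G zero ≢ 0 → ∀ q → F (suc q) ≡ 0
  F-later G0≢0 q with sep zero (suc q) (ℕP.<-≤-trans z<s (ℕP.m≤m+n (suc (toℕ q)) (gap s)))
  ... | inj₁ G0≡0 = ⊥-elim (G0≢0 G0≡0)
  ... | inj₂ Fq≡0 = Fq≡0
  cut-ok : ∀ s → Separable s F G → G zero ≢ 0 → T (cutAllowed s (F zero))
  cut-ok false _   _     = _
  cut-ok true  sep G0≢0 with sep zero zero (s<s z≤n)
  ... | inj₁ G0≡0 = ⊥-elim (G0≢0 G0≡0)
  ... | inj₂ F0≡0 = ℕP.≡⇒≡ᵇ _ 0 F0≡0
  head : T ((G zero ≡ᵇ 0) ∨ (cutAllowed s (F zero) ∧ (Vec.tabulate (F ∘ suc) ==v zeros)))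
  head with G zero ≡ᵇ 0 in G0
  ... | true  = _
  ... | false = Equivalence.from T-∧ (cut-ok s sep G0≢0 , ⇒==v-zeros (F ∘ suc) (F-later G0≢0))
    where
    G0≢0 : G zero ≢ 0
    G0≢0 G0≡0 = subst T G0 (ℕP.≡⇒≡ᵇ _ 0 G0≡0)

before : Bool → ∀ {m n k} → (Fin m → Fin k) → (Fin n → Fin k) → Bool
before s f g = every (λ x → every (λ y → toℕ (f x) ≤ᵇ[ s ] toℕ (g y)))

before≡separated : ∀ s {m n k} (f : Fin m → Fin k) (g : Fin n → Fin k) →
  before s f g ≡ separated s (content f) (content g)
before≡separated s f g = T-injective to from
  where
  #f = λ i → count (λ x → does (f x ≟ᶠ i))
  #g = λ i → count (λ y → does (g y ≟ᶠ i))
  to : T (before s f g) → T (separated s (content f) (content g))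
  to f≤g = Separable⇒separated s #f #g sep
    where
    sep : Separable s #f #g
    sep p q p<q+gap with #g p ℕP.≟ 0
    ... | yes #gp≡0 = inj₁ #gp≡0
    ... | no  #gp≢0 = inj₂ (count≡0 _ λ x → ¬T⇒≡false λ fx≡q →
      let (y , gy≡p) = count≢0⇒witness (λ y → does (g y ≟ᶠ p)) #gp≢0
          fx≤gy = ≤ᵇ[]⇒ s _ _ (every⇒ _ (every⇒ _ f≤g x) y)
      in ℕP.<-irrefl refl (ℕP.<-≤-trans p<q+gap
           (subst₂ (λ u v → u + gap s ≤ v)
                   (cong toℕ (does⇒ (f x ≟ᶠ q) (T⇒≡true fx≡q))) (cong toℕ (does⇒ (g y ≟ᶠ p) gy≡p)) fx≤gy)))
  from : T (separated s (content f) (content g)) → T (before s f g)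
  from t = ⇒every _ λ x → ⇒every _ λ y → ⇒≤ᵇ[] s _ _ (fx≤gy x y)
    where
    fx≤gy : ∀ x y → toℕ (f x) + gap s ≤ toℕ (g y)
    fx≤gy x y with toℕ (f x) + gap s ℕP.≤? toℕ (g y)
    ... | yes fx≤gy = fx≤gy
    ... | no  fx≰gy with separated⇒Separable s #f #g t (g y) (f x) (ℕP.≰⇒> fx≰gy)
    ...   | inj₁ #g≡0 = ⊥-elim (count≢0 (λ y′ → does (g y′ ≟ᶠ g y)) y (dec-true (g y ≟ᶠ g y) refl) #g≡0)
    ...   | inj₂ #f≡0 = ⊥-elim (count≢0 (λ x′ → does (f x′ ≟ᶠ f x)) x (dec-true (f x ≟ᶠ f x) refl) #f≡0)

-- Ordinal sums

join : ∀ {m n k} → (Fin m → Fin k) → (Fin n → Fin k) → Fin (m + n) → Fin k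
join {m} f g x = [ f , g ]′ (splitAt m x)

module _ {m n k} (f : Fin m → Fin k) (g : Fin n → Fin k) where

  join-↑ˡ : ∀ a → join f g (a ↑ˡ n) ≡ f a
  join-↑ˡ a = cong [ f , g ]′ (FinP.splitAt-↑ˡ m a n)

  join-↑ʳ : ∀ b → join f g (m ↑ʳ b) ≡ g b
  join-↑ʳ b = cong [ f , g ]′ (FinP.splitAt-↑ʳ m n b)

  content-join : content (join f g) ≡ content f +v content g
  content-join = trans (VecP.tabulate-cong (λ i → trans (count-++ m n _)
                         (cong₂ _+_ (count-cong (λ a → cong (λ z → does (z ≟ᶠ i)) (join-↑ˡ a)))
                                    (count-cong (λ b → cong (λ z → does (z ≟ᶠ i)) (join-↑ʳ b))))))
                       (tabulate-+ _ _)
    where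
    tabulate-+ : ∀ {k} (A B : Fin k → ℕ) → Vec.tabulate (λ i → A i + B i) ≡ Vec.tabulate A +v Vec.tabulate B
    tabulate-+ {zero}  A B = refl
    tabulate-+ {suc k} A B = cong (A zero + B zero ∷_) (tabulate-+ (A ∘ suc) (B ∘ suc))

join-∷ : ∀ {m n k} (i : Fin k) (f : Fin m → Fin k) (g : Fin n → Fin k) x →
         join {suc m} (i ∷ᶠ f) g x ≡ (i ∷ᶠ join f g) x
join-∷         i f g zero    = refl
join-∷ {m} i f g (suc x) with splitAt m x
... | inj₁ _ = refl
... | inj₂ _ = refl

==ᶠ-true : ∀ {m} {x y : Fin m} → x ≡ y → (x ==ᶠ y) ≡ true
==ᶠ-true {x = x} {y} x≡y with x ≟ᶠ y
... | yes _   = refl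
... | no x≢y = ⊥-elim (x≢y x≡y)

==ᶠ-false : ∀ {m} {x y : Fin m} → x ≢ y → (x ==ᶠ y) ≡ false
==ᶠ-false {x = x} {y} x≢y with x ≟ᶠ y
... | yes x≡y = ⊥-elim (x≢y x≡y)
... | no _    = refl

==ᶠ-injective : ∀ {m n} (h : Fin m → Fin n) → (∀ a a' → h a ≡ h a' → a ≡ a') → ∀ a a' → (h a ==ᶠ h a') ≡ (a ==ᶠ a')
==ᶠ-injective h h-inj a a' with a ≟ᶠ a'
... | yes a≡a' = ==ᶠ-true (cong h a≡a')
... | no  a≢a' = ==ᶠ-false (λ e → a≢a' (h-inj a a' e))

↑ˡ≢↑ʳ : ∀ {m n} (a : Fin m) (b : Fin n) → a ↑ˡ n ≢ m ↑ʳ b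
↑ˡ≢↑ʳ {m} {n} a b e = ℕP.<⇒≢ (ℕP.<-≤-trans (FinP.toℕ<n a) (ℕP.m≤m+n m (toℕ b)))
                              (trans (sym (FinP.toℕ-↑ˡ a n)) (trans (cong toℕ e) (FinP.toℕ-↑ʳ m b)))

ppCondition : (related equal : Bool) (fa fb : ℕ) (descent : Bool) → Bool
ppCondition related equal fa fb descent =
  if related ∧ not equal then (fa ≤ᵇ fb) ∧ (if descent then fa <ᵇ fb else true) else true

ppConditionAt : ∀ {N k} (R : LPoset N) (e : Fin N → Fin k) → Fin N → Fin N → Bool
ppConditionAt R e x y = ppCondition (le R x y) (x ==ᶠ y) (toℕ (e x)) (toℕ (e y)) (toℕ (ω R y) <ᵇ toℕ (ω R x))

isPPartition≡every : ∀ {n k} (P : LPoset n) (f : Fin n → Fin k) → isPPartition P f ≡ every (λ a → every (ppConditionAt P f a))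
isPPartition≡every P f = trans (allᶠ≡every (λ a → allᶠ (ppConditionAt P f a))) (every-cong (λ a → allᶠ≡every (ppConditionAt P f a)))

ppCondition-cross : ∀ s fa fb → ppCondition true false fa fb s ≡ fa ≤ᵇ[ s ] fb
ppCondition-cross false fa fb = ∧-identityʳ _
ppCondition-cross true  fa fb with fa <ᵇ fb in fa<fb
... | false = ∧-zeroʳ _
... | true  rewrite T⇒≡true (ℕP.≤⇒≤ᵇ (ℕP.<⇒≤ (ℕP.<ᵇ⇒< fa fb (subst T (sym fa<fb) _)))) = refl

-- Every edge from P to Q is a descent of the labelling exactly when s = true, i.e. strict.
record IsOrdinalSum (s : Bool) {m n} (P : LPoset m) (Q : LPoset n) (PQ : LPoset (m + n)) : Set where
  field
    le-sumLe      : ∀ x y → le PQ x y ≡ sumLe (le P) (le Q) x y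
    descent-left  : ∀ a a' → (toℕ (ω PQ (a' ↑ˡ n)) <ᵇ toℕ (ω PQ (a ↑ˡ n))) ≡ (toℕ (ω P a') <ᵇ toℕ (ω P a))
    descent-right : ∀ b b' → (toℕ (ω PQ (m ↑ʳ b')) <ᵇ toℕ (ω PQ (m ↑ʳ b))) ≡ (toℕ (ω Q b') <ᵇ toℕ (ω Q b))
    descent-cross : ∀ a b → (toℕ (ω PQ (m ↑ʳ b)) <ᵇ toℕ (ω PQ (a ↑ˡ n))) ≡ s

module _ {m n} (R : Fin m → Fin m → Bool) (R' : Fin n → Fin n → Bool) where

  sumLe-↑ˡ-↑ˡ : ∀ a a' → sumLe R R' (a ↑ˡ n) (a' ↑ˡ n) ≡ R a a'
  sumLe-↑ˡ-↑ˡ a a' rewrite FinP.splitAt-↑ˡ m a n | FinP.splitAt-↑ˡ m a' n = refl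

  sumLe-↑ˡ-↑ʳ : ∀ a b → sumLe R R' (a ↑ˡ n) (m ↑ʳ b) ≡ true
  sumLe-↑ˡ-↑ʳ a b rewrite FinP.splitAt-↑ˡ m a n | FinP.splitAt-↑ʳ m n b = refl

  sumLe-↑ʳ-↑ˡ : ∀ b a → sumLe R R' (m ↑ʳ b) (a ↑ˡ n) ≡ false
  sumLe-↑ʳ-↑ˡ b a rewrite FinP.splitAt-↑ˡ m a n | FinP.splitAt-↑ʳ m n b = refl

  sumLe-↑ʳ-↑ʳ : ∀ b b' → sumLe R R' (m ↑ʳ b) (m ↑ʳ b') ≡ R' b b'
  sumLe-↑ʳ-↑ʳ b b' rewrite FinP.splitAt-↑ʳ m n b | FinP.splitAt-↑ʳ m n b' = refl

every²-++ : ∀ m n (C : Fin (m + n) → Fin (m + n) → Bool) →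
  every (λ x → every (C x)) ≡
  (every (λ a → every (λ a' → C (a ↑ˡ n) (a' ↑ˡ n))) ∧ every (λ a → every (λ b → C (a ↑ˡ n) (m ↑ʳ b)))) ∧
  (every (λ b → every (λ a → C (m ↑ʳ b) (a ↑ˡ n))) ∧ every (λ b → every (λ b' → C (m ↑ʳ b) (m ↑ʳ b'))))
every²-++ m n C = trans (every-++ m n (λ x → every (C x)))
  (cong₂ _∧_ (trans (every-cong (λ a → every-++ m n (C (a ↑ˡ n))))
                    (every-∧ (λ a → every (λ a' → C (a ↑ˡ n) (a' ↑ˡ n))) (λ a → every (λ b → C (a ↑ˡ n) (m ↑ʳ b)))))
             (trans (every-cong (λ b → every-++ m n (C (m ↑ʳ b))))
                    (every-∧ (λ b → every (λ a → C (m ↑ʳ b) (a ↑ˡ n))) (λ b → every (λ b' → C (m ↑ʳ b) (m ↑ʳ b'))))))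

∑-allFuns-join : ∀ m n k (φ : (Fin (m + n) → Fin k) → ℤ) → (∀ h h' → (∀ x → h x ≡ h' x) → φ h ≡ φ h') →
  ∑ φ (allFuns (m + n) k) ≡ ∑ (λ f → ∑ (λ g → φ (join f g)) (allFuns n k)) (allFuns m k)
∑-allFuns-join zero    n k φ φ-ext = sym (ℤP.+-identityʳ _)
∑-allFuns-join (suc m) n k φ φ-ext = begin
  ∑ φ (allFuns (suc m + n) k)
    ≡⟨ ∑-concatMap φ (λ i → map (i ∷ᶠ_) (allFuns (m + n) k)) (List.allFin k) ⟩
  ∑ (λ i → ∑ φ (map (i ∷ᶠ_) (allFuns (m + n) k))) (List.allFin k)
    ≡⟨ ∑-cong (List.allFin k) (λ i → trans (∑-map φ (i ∷ᶠ_) (allFuns (m + n) k))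
         (∑-allFuns-join m n k (λ h → φ (i ∷ᶠ h)) (λ h h' h≗h' → φ-ext _ _ (∷ᶠ-cong i h≗h')))) ⟩
  ∑ (λ i → ∑ (λ f → ∑ (λ g → φ (i ∷ᶠ join f g)) (allFuns n k)) (allFuns m k)) (List.allFin k)
    ≡⟨ ∑-cong (List.allFin k) (λ i → trans
         (∑-cong (allFuns m k) (λ f → ∑-cong (allFuns n k) (λ g → sym (φ-ext _ _ (join-∷ i f g)))))
         (sym (∑-map (λ f → ∑ (λ g → φ (join f g)) (allFuns n k)) (i ∷ᶠ_) (allFuns m k)))) ⟩
  ∑ (λ i → ∑ (λ f → ∑ (λ g → φ (join f g)) (allFuns n k)) (map (i ∷ᶠ_) (allFuns m k))) (List.allFin k)
    ≡⟨ ∑-concatMap (λ f → ∑ (λ g → φ (join f g)) (allFuns n k)) (λ i → map (i ∷ᶠ_) (allFuns m k)) (List.allFin k) ⟨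
  ∑ (λ f → ∑ (λ g → φ (join f g)) (allFuns n k)) (allFuns (suc m) k) ∎
  where
  open ≡-Reasoning
  ∷ᶠ-cong : ∀ {N} (i : Fin k) {h h' : Fin N → Fin k} → (∀ x → h x ≡ h' x) → ∀ x → (i ∷ᶠ h) x ≡ (i ∷ᶠ h') x
  ∷ᶠ-cong i h≗h' zero    = refl
  ∷ᶠ-cong i h≗h' (suc x) = h≗h' x

isPPartition-cong : ∀ {N k} (R : LPoset N) {h h' : Fin N → Fin k} → (∀ x → h x ≡ h' x) → isPPartition R h ≡ isPPartition R h'
isPPartition-cong R {h} {h'} h≗h' =
  trans (isPPartition≡every R h)
        (trans (every-cong (λ x → every-cong (λ y → cong₂ (λ u v → ppCondition (le R x y) (x ==ᶠ y) (toℕ u) (toℕ v) _)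
                                                          (h≗h' x) (h≗h' y))))
               (sym (isPPartition≡every R h')))

hasContent-cong : ∀ {N k} {h h' : Fin N → Fin k} → (∀ x → h x ≡ h' x) → ∀ u → hasContent h u ≡ hasContent h' u
hasContent-cong {h = h} {h'} h≗h' u =
  trans (hasContent≡content-==v h u)
        (trans (cong (_==v u) (VecP.tabulate-cong (λ i → count-cong (λ x → cong (λ z → does (z ≟ᶠ i)) (h≗h' x)))))
               (sym (hasContent≡content-==v h' u)))

module _ {s m n} {P : LPoset m} {Q : LPoset n} {PQ : LPoset (m + n)} (PQ-sum : IsOrdinalSum s P Q PQ) where
  open IsOrdinalSum PQ-sum

  isPPartition-join : ∀ {k} (f : Fin m → Fin k) (g : Fin n → Fin k) →
    isPPartition PQ (join f g) ≡ isPPartition P f ∧ (isPPartition Q g ∧ before s f g)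
  isPPartition-join f g = begin
    isPPartition PQ h
      ≡⟨ isPPartition≡every PQ h ⟩
    every (λ x → every (c x))
      ≡⟨ every²-++ m n (c) ⟩
    (every (λ a → every (λ a' → c (a ↑ˡ n) (a' ↑ˡ n))) ∧ every (λ a → every (λ b → c (a ↑ˡ n) (m ↑ʳ b)))) ∧
      (every (λ b → every (λ a → c (m ↑ʳ b) (a ↑ˡ n))) ∧ every (λ b → every (λ b' → c (m ↑ʳ b) (m ↑ʳ b'))))
      ≡⟨ cong₂ _∧_ (cong₂ _∧_ (every-cong λ a → every-cong λ a' → left-left a a') (every-cong λ a → every-cong λ b → left-right a b))
                   (cong₂ _∧_ (trans (every-cong λ b → trans (every-cong λ a → right-left b a) (every-true m)) (every-true n))
                              (every-cong λ b → every-cong λ b' → right-right b b')) ⟩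
    (every (λ a → every (ppConditionAt P f a)) ∧ before s f g) ∧ (true ∧ every (λ b → every (ppConditionAt Q g b)))
      ≡⟨ cong₂ (λ x y → (x ∧ before s f g) ∧ y) (isPPartition≡every P f) (isPPartition≡every Q g) ⟨
    (isPPartition P f ∧ before s f g) ∧ isPPartition Q g
      ≡⟨ rearrange (isPPartition P f) (isPPartition Q g) (before s f g) ⟩
    isPPartition P f ∧ (isPPartition Q g ∧ before s f g) ∎
    where
    open ≡-Reasoning
    h = join f g
    c = ppConditionAt PQ h
    left-left : ∀ a a' → c (a ↑ˡ n) (a' ↑ˡ n) ≡ ppConditionAt P f a a'
    left-left a a' rewrite le-sumLe (a ↑ˡ n) (a' ↑ˡ n) | sumLe-↑ˡ-↑ˡ (le P) (le Q) a a'
                         | ==ᶠ-injective (_↑ˡ n) (FinP.↑ˡ-injective n) a a'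
                         | join-↑ˡ f g a | join-↑ˡ f g a' | descent-left a a' = refl
    left-right : ∀ a b → c (a ↑ˡ n) (m ↑ʳ b) ≡ toℕ (f a) ≤ᵇ[ s ] toℕ (g b)
    left-right a b rewrite le-sumLe (a ↑ˡ n) (m ↑ʳ b) | sumLe-↑ˡ-↑ʳ (le P) (le Q) a b | ==ᶠ-false (↑ˡ≢↑ʳ a b)
                         | join-↑ˡ f g a | join-↑ʳ f g b | descent-cross a b = ppCondition-cross s _ _
    right-left : ∀ b a → c (m ↑ʳ b) (a ↑ˡ n) ≡ true
    right-left b a rewrite le-sumLe (m ↑ʳ b) (a ↑ˡ n) | sumLe-↑ʳ-↑ˡ (le P) (le Q) b a = refl
    right-right : ∀ b b' → c (m ↑ʳ b) (m ↑ʳ b') ≡ ppConditionAt Q g b b'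
    right-right b b' rewrite le-sumLe (m ↑ʳ b) (m ↑ʳ b') | sumLe-↑ʳ-↑ʳ (le P) (le Q) b b'
                           | ==ᶠ-injective (m ↑ʳ_) (FinP.↑ʳ-injective m) b b'
                           | join-↑ʳ f g b | join-↑ʳ f g b' | descent-right b b' = refl
    rearrange : ∀ x y z → (x ∧ z) ∧ y ≡ x ∧ (y ∧ z)
    rearrange true  true  z = ∧-identityʳ z
    rearrange true  false z = ∧-zeroʳ z
    rearrange false y     z = refl

  K-ordinalSum : ∀ k (a : Vec ℕ k) → K PQ k a ≡ splitSum s a (λ u v → K P k u * K Q k v)
  K-ordinalSum k a = begin
    K PQ k a
      ≡⟨ length-filter≡∑𝟙 (λ h → isPPartition PQ h ∧ hasContent h a) (allFuns (m + n) k) ⟩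
    ∑ (λ h → 𝟙 (isPPartition PQ h ∧ hasContent h a)) (allFuns (m + n) k)
      ≡⟨ ∑-allFuns-join m n k _ (λ h h' h≗h' → cong 𝟙 (cong₂ _∧_ (isPPartition-cong PQ h≗h') (hasContent-cong h≗h' a))) ⟩
    ∑ (λ f → ∑ (λ g → 𝟙 (isPPartition PQ (join f g) ∧ hasContent (join f g) a)) Gs) Fs
      ≡⟨ ∑-cong Fs (λ f → ∑-cong Gs (λ g → joined-count f g)) ⟩
    ∑ (λ f → ∑ (λ g → splitSum s a (pair f g)) Gs) Fs
      ≡⟨ trans (splitSum-∑ s a (λ f u v → ∑ (λ g → pair f g u v) Gs) Fs)
               (∑-cong Fs (λ f → splitSum-∑ s a (pair f) Gs)) ⟨
    splitSum s a (λ u v → ∑ (λ f → ∑ (λ g → pair f g u v) Gs) Fs)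
      ≡⟨ splitSum-cong s a (λ u v → sym (trans (cong₂ _*_ (counts P u) (counts Q v)) (∑-*-∑ _ _ Fs Gs))) ⟩
    splitSum s a (λ u v → K P k u * K Q k v) ∎
    where
    open ≡-Reasoning
    Fs = allFuns m k
    Gs = allFuns n k
    pair : (Fin m → Fin k) → (Fin n → Fin k) → Vec ℕ k → Vec ℕ k → ℤ
    pair f g u v = 𝟙 (isPPartition P f ∧ hasContent f u) * 𝟙 (isPPartition Q g ∧ hasContent g v)
    counts : ∀ {N} (R : LPoset N) u → K R k u ≡ ∑ (λ h → 𝟙 (isPPartition R h ∧ hasContent h u)) (allFuns N k)
    counts {N} R u = length-filter≡∑𝟙 (λ h → isPPartition R h ∧ hasContent h u) (allFuns N k)
    joined-count : ∀ f g → 𝟙 (isPPartition PQ (join f g) ∧ hasContent (join f g) a) ≡ splitSum s a (pair f g)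
    joined-count f g = begin
      𝟙 (isPPartition PQ (join f g) ∧ hasContent (join f g) a)
        ≡⟨ cong 𝟙 (cong₂ _∧_ (trans (isPPartition-join f g) (cong (λ z → pf ∧ (pg ∧ z)) (before≡separated s f g)))
                             (trans (hasContent≡content-==v (join f g) a) (cong (_==v a) (content-join f g)))) ⟩
      𝟙 ((pf ∧ (pg ∧ separated s cf cg)) ∧ ((cf +v cg) ==v a))
        ≡⟨ 𝟙-rearrange pf pg (separated s cf cg) ((cf +v cg) ==v a) ⟩
      (𝟙 pf * 𝟙 pg) * (𝟙 (separated s cf cg) * 𝟙 ((cf +v cg) ==v a))
        ≡⟨ cong ((𝟙 pf * 𝟙 pg) *_) (splitSum-pointMass s a cf cg) ⟨
      (𝟙 pf * 𝟙 pg) * splitSum s a (pointMass cf cg)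
        ≡⟨ splitSum-*ˡ s a (𝟙 pf * 𝟙 pg) (pointMass cf cg) ⟨
      splitSum s a (λ u v → (𝟙 pf * 𝟙 pg) * pointMass cf cg u v)
        ≡⟨ splitSum-cong s a (λ u v → trans (cong₂ (λ x y → (𝟙 pf * 𝟙 pg) * (𝟙 x * 𝟙 y)) (sym (hasContent≡content-==v f u)) (sym (hasContent≡content-==v g v)))
                                            (sym (𝟙-split pf (hasContent f u) pg (hasContent g v)))) ⟩
      splitSum s a (pair f g) ∎
      where
      pf = isPPartition P f
      pg = isPPartition Q g
      cf = content f
      cg = content g
      𝟙-rearrange : ∀ a b c d → 𝟙 ((a ∧ (b ∧ c)) ∧ d) ≡ (𝟙 a * 𝟙 b) * (𝟙 c * 𝟙 d)
      𝟙-rearrange a b c d rewrite 𝟙-∧ (a ∧ (b ∧ c)) d | 𝟙-∧ a (b ∧ c) | 𝟙-∧ b c = reassociate (𝟙 a) (𝟙 b) (𝟙 c) (𝟙 d)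
        where
        reassociate : ∀ a b c d → (a * (b * c)) * d ≡ (a * b) * (c * d)
        reassociate = solve-∀
      𝟙-split : ∀ a b c d → 𝟙 (a ∧ b) * 𝟙 (c ∧ d) ≡ (𝟙 a * 𝟙 c) * (𝟙 b * 𝟙 d)
      𝟙-split a b c d rewrite 𝟙-∧ a b | 𝟙-∧ c d = interchange (𝟙 a) (𝟙 b) (𝟙 c) (𝟙 d)
        where
        interchange : ∀ a b c d → (a * b) * (c * d) ≡ (a * c) * (b * d)
        interchange = solve-∀

module _ {m n} (P : LPoset m) (Q : LPoset n) where

  ω-↑P-↑ˡ : ∀ a → toℕ (ω (P ↑P Q) (a ↑ˡ n)) ≡ toℕ (ω P a)
  ω-↑P-↑ˡ a rewrite FinP.splitAt-↑ˡ m a n = FinP.toℕ-↑ˡ (ω P a) n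

  ω-↑P-↑ʳ : ∀ b → toℕ (ω (P ↑P Q) (m ↑ʳ b)) ≡ m + toℕ (ω Q b)
  ω-↑P-↑ʳ b rewrite FinP.splitAt-↑ʳ m n b = FinP.toℕ-↑ʳ m (ω Q b)

  ω-⇑P-↑ˡ : ∀ a → toℕ (ω (P ⇑P Q) (a ↑ˡ n)) ≡ n + toℕ (ω P a)
  ω-⇑P-↑ˡ a rewrite FinP.splitAt-↑ˡ m a n = trans (FinP.toℕ-cast _ (n ↑ʳ ω P a)) (FinP.toℕ-↑ʳ n (ω P a))

  ω-⇑P-↑ʳ : ∀ b → toℕ (ω (P ⇑P Q) (m ↑ʳ b)) ≡ toℕ (ω Q b)
  ω-⇑P-↑ʳ b rewrite FinP.splitAt-↑ʳ m n b = trans (FinP.toℕ-cast _ (ω Q b ↑ˡ m)) (FinP.toℕ-↑ˡ (ω Q b) m)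

  ↑P-isOrdinalSum : IsOrdinalSum false P Q (P ↑P Q)
  ↑P-isOrdinalSum = record
    { le-sumLe      = λ _ _ → refl
    ; descent-left  = λ a a' → cong₂ _<ᵇ_ (ω-↑P-↑ˡ a') (ω-↑P-↑ˡ a)
    ; descent-right = λ b b' → trans (cong₂ _<ᵇ_ (ω-↑P-↑ʳ b') (ω-↑P-↑ʳ b)) (<ᵇ-+ˡ m _ _)
    ; descent-cross = λ a b → trans (cong₂ _<ᵇ_ (ω-↑P-↑ʳ b) (ω-↑P-↑ˡ a))
                                    (<ᵇ-≥ (ℕP.≤-trans (ℕP.<⇒≤ (FinP.toℕ<n (ω P a))) (ℕP.m≤m+n m _)))
    }

  ⇑P-isOrdinalSum : IsOrdinalSum true P Q (P ⇑P Q)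
  ⇑P-isOrdinalSum = record
    { le-sumLe      = λ _ _ → refl
    ; descent-left  = λ a a' → trans (cong₂ _<ᵇ_ (ω-⇑P-↑ˡ a') (ω-⇑P-↑ˡ a)) (<ᵇ-+ˡ n _ _)
    ; descent-right = λ b b' → cong₂ _<ᵇ_ (ω-⇑P-↑ʳ b') (ω-⇑P-↑ʳ b)
    ; descent-cross = λ a b → trans (cong₂ _<ᵇ_ (ω-⇑P-↑ʳ b) (ω-⇑P-↑ˡ a))
                                    (<ᵇ-< (ℕP.<-≤-trans (FinP.toℕ<n (ω Q b)) (ℕP.m≤m+n n _)))
    }

K-ordinalSum-combo : ∀ s {m n} {P : LPoset m} {Q : LPoset n} {PQ : LPoset (m + n)} → IsOrdinalSum s P Q PQ →
  (_⋆_ : List ℕ → List ℕ → List ℕ) → (∀ α β → Positive α → Positive β → Positive (α ⋆ β)) →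
  (∀ α β → Positive α → Positive β → ∀ {k} (a : Vec ℕ k) → splitSum s a (fcoeff⊗ α β) ≡ fcoeff (α ⋆ β) (nonzeros a)) →
  (c d : List ℕ → ℤ) → K P ≈ˢ combo m c → K Q ≈ˢ combo n d → K PQ ≈ˢ prodCombo _⋆_ m n c d
K-ordinalSum-combo s {m} {n} {P} {Q} {PQ} PQ-sum _⋆_ positive-⋆ splitSum-fcoeff⊗ c d KP≈ KQ≈ k a = begin
  K PQ k a                                             ≡⟨ K-ordinalSum PQ-sum k a ⟩
  splitSum s a (λ u v → K P k u * K Q k v)             ≡⟨ splitSum-cong s a (λ u v → cong₂ _*_ (KP≈ k u) (KQ≈ k v)) ⟩
  splitSum s a (λ u v → combo m c k u * combo n d k v) ≡⟨ splitSum-combo s _⋆_ positive-⋆ splitSum-fcoeff⊗ m n c d k a ⟩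
  prodCombo _⋆_ m n c d k a                            ∎
  where open ≡-Reasoning

proposition4p6 : ∀ {m n} (P : LPoset m) (Q : LPoset n) →
    IsLabeledPoset P → IsLabeledPoset Q →
    (c d : List ℕ → ℤ) →
    K P ≈ˢ combo m c → K Q ≈ˢ combo n d →
    (K (P ↑P Q) ≈ˢ prodCombo _↑c_ m n c d) × (K (P ⇑P Q) ≈ˢ prodCombo _⇑c_ m n c d)
proposition4p6 P Q _ _ c d KP≈ KQ≈ =
  K-ordinalSum-combo false (↑P-isOrdinalSum P Q) _↑c_ positive-↑c splitSum-fcoeff⊗-↑ c d KP≈ KQ≈ ,
  K-ordinalSum-combo true  (⇑P-isOrdinalSum P Q) _⇑c_ positive-++ splitSum-fcoeff⊗-⇑ c d KP≈ KQ≈
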